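{- Let $s,t,D\ge1$. Let $\mathcal H$ be a $[t]$-edge-colored rooted graph with $\Delta^{mon}(\mathcal H)\le D$, and let $\mathcal H_0$ be a subgraph of $\mathcal H$ obtainable from $\mathcal H$ by a sequence of removals of non-root leaves (with the inherited rooted structure). Let $\mathcal G=\{G_1,\dots,G_t\}$ be an $s$-joined graph family and let $\phi_0:\mathcal H_0\hookrightarrow\mathcal G$ be a $(2s,D)$-good embedding. If $|V(\mathcal H)|\le|V(\mathcal G)|-2sD-3s$, then there exists a $(2s,D)$-good embedding $\phi:\mathcal H\hookrightarrow\mathcal G$ extending $\phi_0$.
   Context: $\mathcal G$ is a family of graphs on a common vertex set $V=V(\mathcal G)$; it is $s$-joined if for all $X\subseteq V\times[t]$, $Y\subseteq V$ with $|X|,|Y|\ge s$ there exist $(x,i)\in X$, $y\in Y$ with $xy\in E(G_i)$. A $[t]$-edge-colored graph has edges colored from $[t]$; $H_i$ is its color-$i$ subgraph; $\Delta^{mon}=\max_i\Delta(H_i)$. An embedding is an injective map $\phi:V(\mathcal H)\to V$ with $\phi(x)\phi(y)\in E(G_i)$ for every edge $xy$ of color $i$. For $X\subseteq V\times[t]$, $\Gamma_{\mathcal G}(X)=\bigcup_{(v,i)\in X}\Gamma_{G_i}(v)$. A rooted graph has a distinguished root set such that each non-root vertex $h$ has a unique path to the root set meeting it only at its last vertex; the neighbour of $h$ on it is its parent; a non-root leaf is a non-root vertex of degree $1$. $R(X,\phi)=|\Gamma_{\mathcal G}(X)\setminus\phi(V(\mathcal H))|-\sum_{(v,i)\in X}[D-\deg_{H_i}(\phi^{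 -1}(v))]-|P_\phi(\mathcal H)\cap X|$, with $\deg_{H_i}(\phi^{ -1}(v))=0$ for $v\notin\phi(V(\mathcal H))$ and $P_\phi(\mathcal H)$ the set of $(\phi(h),i)$ with $h$ non-root and $i$ the color of the edge from $h$ to its parent. $\phi$ is $(2s,D)$-good if $R(X,\phi)\ge0$ for all $X\subseteq V\times[t]$ with $|X|\le 2s$. -}

module Defs where

open import Data.Nat using (ℕ; zero; suc; _+_; _*_; _∸_; _≤_)
open import Data.Integer as ℤ using (ℤ; +_)
open import Data.Fin using (Fin; zero; suc)
open import Data.Fin.Properties using (any?) renaming (_≟_ to _≟ᶠ_)
open import Data.Fin.Subset using (Subset; _∈_; _∉_; ∣_∣; _∩_; _─_; ⊤; _-_)
open import Data.Fin.Subset.Properties using (_∈?_)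
open import Data.Maybe using (Maybe; just; nothing; maybe)
open import Data.Maybe.Properties using (≡-dec)
open import Data.List using (List; []; _∷_)
open import Data.List.Relation.Unary.Unique.Propositional using (Unique)
open import Data.Product using (Σ; ∃; ∃-syntax; _×_; _,_; proj₁; proj₂)
open import Data.Empty using (⊥-elim)
open import Data.Vec using (tabulate)
import Data.Bool
import Relation.Nullary
open import Relation.Nullary using (Dec; yes; no; does; ¬_)
open import Relation.Nullary.Decidable using (_×-dec_)
open import Relation.Binary.PropositionalEquality using (_≡_)

sumFin : (n : ℕ) → (Fin n → ℕ) → ℕ
sumFin zero    f = 0
sumFin (suc n) f = f zero + sumFin n (λ i → f (suc i))

sumFinℤ : (n : ℕ) → (Fin n → ℤ) → ℤ
sumFinℤ zero    f = + 0
sumFinℤ (suc n) f = f zero ℤ.+ sumFinℤ n (λ i → f (suc i))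

⟦_⟧ : ∀ {n} {P : Fin n → Set} → ((x : Fin n) → Dec (P x)) → Subset n
⟦ P? ⟧ = tabulate (λ x → does (P? x))

record GraphFamily (t n : ℕ) : Set where
  field
    adj    : Fin t → Fin n → Subset n
    sym    : ∀ i u v → v ∈ adj i u → u ∈ adj i v
    irrefl : ∀ i v → v ∉ adj i v
open GraphFamily public

-- A subset X ⊆ V × [t] is represented as  X : Fin n → Subset t
-- ((v , i) ∈ X  iff  i ∈ X v).
PairSet : ℕ → ℕ → Set
PairSet n t = Fin n → Subset t

∣_∣ₚ : ∀ {n t} → PairSet n t → ℕ
∣_∣ₚ {n} X = sumFin n (λ v → ∣ X v ∣)

SJoined : ∀ {t n} → ℕ → GraphFamily t n → Set
SJoined {t} {n} s 𝒢 =
  (X : PairSet n t) (Y : Subset n) → s ≤ ∣ X ∣ₚ → s ≤ ∣ Y ∣ →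
  ∃[ x ] ∃[ i ] ∃[ y ] (i ∈ X x × y ∈ Y × y ∈ adj 𝒢 i x)

Γ : ∀ {t n} → GraphFamily t n → PairSet n t → Subset n
Γ {t} {n} 𝒢 X =
  ⟦ (λ w → any? (λ v → any? (λ i → (i ∈? X v) ×-dec (w ∈? adj 𝒢 i v)))) ⟧

-- [t]-edge-coloured graphs on vertex set Fin m.
-- col x y = just i : xy is an edge of colour i;  nothing : not an edge.

record ColGraph (t m : ℕ) : Set where
  field
    col    : Fin m → Fin m → Maybe (Fin t)
    sym    : ∀ x y → col x y ≡ col y x
    irrefl : ∀ x → col x x ≡ nothing
open ColGraph public

module _ {t m : ℕ} (H : ColGraph t m) where

  degIn : Subset m → Fin t → Fin m → ℕ
  degIn S i h = ∣ ⟦ (λ y → (y ∈? S) ×-dec (≡-dec _≟ᶠ_ (col H h y) (just i))) ⟧ ∣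

  deg : Fin t → Fin m → ℕ
  deg = degIn ⊤

  degAllIn : Subset m → Fin m → ℕ
  degAllIn S h = ∣ ⟦ (λ y → (y ∈? S) ×-dec
                       (Relation.Nullary.¬? (≡-dec _≟ᶠ_ (col H h y) nothing))) ⟧ ∣

  MaxMonDeg≤ : ℕ → Set
  MaxMonDeg≤ D = ∀ i h → deg i h ≤ D

  data RootWalk (R : Subset m) : Fin m → List (Fin m) → Set where
    stop : ∀ {h} → h ∈ R → RootWalk R h []
    step : ∀ {h y ys} → h ∉ R → (c : Fin t) → col H h y ≡ just c →
           RootWalk R y ys → RootWalk R h (y ∷ ys)

  RootPath : Subset m → Fin m → List (Fin m) → Set
  RootPath R h ys = RootWalk R h ys × Unique (h ∷ ys)

  firstColour : ∀ {R h ys} → RootWalk R h ys → h ∉ R → Fin t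
  firstColour (stop h∈R)      h∉R = ⊥-elim (h∉R h∈R)
  firstColour (step _ c _ _) _   = c

record Rooted {t m : ℕ} (H : ColGraph t m) : Set where
  field
    roots : Subset m
    paths : ∀ h → h ∉ roots →
            Σ (List (Fin m)) λ ys → RootPath H roots h ys ×
              (∀ zs → RootPath H roots h zs → zs ≡ ys)
open Rooted public

module _ {t m : ℕ} {H : ColGraph t m} (ρ : Rooted H) where

  parentColour : Fin m → Maybe (Fin t)
  parentColour h with h ∈? roots ρ
  ... | yes _  = nothing
  ... | no h∉R = just (firstColour H (proj₁ (proj₁ (proj₂ (paths ρ h h∉R)))) h∉R)

  NonRootLeafIn : Subset m → Fin m → Set
  NonRootLeafIn S ℓ = ℓ ∈ S × ℓ ∉ roots ρ × degAllIn H S ℓ ≡ 1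

  -- S induces a subgraph obtainable from H by successively removing
  -- non-root leaves (H₀ = H[S] with the inherited rooted structure)
  data LeafRemoved : Subset m → Set where
    start  : LeafRemoved ⊤
    remove : ∀ {S ℓ} → LeafRemoved S → NonRootLeafIn S ℓ → LeafRemoved (S - ℓ)

-- Embeddings of the induced rooted subgraph H[S] into 𝒢.
-- A map is φ : Fin m → Fin n, of which only the values on S matter.

module _ {t m n : ℕ} {H : ColGraph t m} (ρ : Rooted H) (𝒢 : GraphFamily t n)
         (S : Subset m) (φ : Fin m → Fin n) where

  IsEmbedding : Set
  IsEmbedding =
    (∀ x y → x ∈ S → y ∈ S → φ x ≡ φ y → x ≡ y) ×
    (∀ x y i → x ∈ S → y ∈ S → col H x y ≡ just i → φ y ∈ adj 𝒢 i (φ x))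

  image : Subset n
  image = ⟦ (λ w → any? (λ h → (h ∈? S) ×-dec (φ h ≟ᶠ w))) ⟧

  preimage : Fin n → Maybe (Fin m)
  preimage v with any? (λ h → (h ∈? S) ×-dec (φ h ≟ᶠ v))
  ... | yes (h , _) = just h
  ... | no _        = nothing

  degAt : Fin t → Fin n → ℕ
  degAt i v = maybe (degIn H S i) 0 (preimage v)

  P : PairSet n t
  P v = ⟦ (λ i → any? (λ h → (h ∈? S) ×-dec ((φ h ≟ᶠ v) ×-dec
                 (≡-dec _≟ᶠ_ (parentColour ρ h) (just i))))) ⟧

  Rval : ℕ → PairSet n t → ℤ
  Rval D X =
    (+ ∣ Γ 𝒢 X ─ image ∣)
    ℤ.- sumFinℤ n (λ v → sumFinℤ t (λ i →
            Data.Bool.if does (i ∈? X v) then (+ D) ℤ.- (+ degAt i v) else + 0))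
    ℤ.- (+ sumFin n (λ v → ∣ P v ∩ X v ∣))

  Good : ℕ → ℕ → Set
  Good s D = (X : PairSet n t) → ∣ X ∣ₚ ≤ 2 * s → + 0 ℤ.≤ Rval D X

module Submission where

-- The leaves are put back one at a time, in the reverse order of their removal. Write
-- R(X) = free X − demand X, where free X counts the vertices of Γ(X) outside the image and
-- demand X sums D − deg_{H_i}(φ⁻¹ v) + [(v , i) ∈ P_φ] over (v , i) ∈ X; goodness says R ≥ 0
-- on sets of size at most 2s. A leaf ℓ whose parent sits at v, joined to it in colour c, is
-- sent to a candidate y ∈ Γ_{G_c}(v) outside the image. This lowers free X by at most one, and
-- only if y ∈ Γ(X), while it does not raise demand X and lowers it when (v , c) ∈ X. Hence if
-- the choice y fails, some X_y with y ∈ Γ(X_y) and (v , c) ∉ X_y was already critical (R ≤ 0),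
-- and small (|X_y| < s) because s-joinedness and the size of V force R > 0 on sets of size
-- between s and 2s. As free is submodular and demand modular, small critical sets are closed
-- under union. If every candidate failed, the union W of the X_y has all candidates in Γ(W),
-- so adding (v , c) to W does not change free but raises demand by D − deg_{H_c}(parent) ≥ 1,
-- making R negative on a set of size at most s.

open import Defs hiding (sym)
open import Data.Bool using (true; false; if_then_else_)
open import Data.Fin using (Fin; zero; suc)
open import Data.Fin.Properties using (any?) renaming (_≟_ to _≟ᶠ_)
open import Data.Fin.Subset
  using (Subset; _∈_; _∉_; _⊆_; ⊤; ⊥; ∁; ∣_∣; _∩_; _∪_; _─_; _-_; ⁅_⁆; inside; outside; Nonempty)
open import Data.Fin.Subset.Properties
open import Data.Integer as ℤ using (ℤ)
import Data.Integer.Properties as ℤP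
open import Data.List using ([]; _∷_)
open import Data.List.Relation.Unary.All using (All; []; _∷_; universal)
open import Data.List.Relation.Unary.AllPairs using (_∷_)
open import Data.List.Relation.Unary.Unique.Propositional using (Unique)
open import Data.Maybe using (Maybe; just; nothing)
open import Data.Maybe.Properties using (≡-dec; just-injective)
open import Data.Nat using (ℕ; zero; suc; _+_; _*_; _∸_; _≤_; _<_; z≤n; s≤s)
open import Data.Nat.Properties
open import Algebra.Properties.CommutativeSemigroup +-commutativeSemigroup
  using () renaming (interchange to +-interchange; x∙yz≈y∙xz to m+[n+o]≡n+[m+o])
open import Data.Nat.Tactic.RingSolver using (solve-∀)
open import Data.Product using (Σ; ∃; ∃-syntax; _×_; _,_; proj₁; proj₂)
open import Data.Sum using (_⊎_; inj₁; inj₂; [_,_]′)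
open import Data.Vec using ([]; _∷_; here; there)
open import Data.Vec.Functional using () renaming ([] to []ᶠ; _∷_ to _∷ᶠ_)
open import Data.Vec.Properties using ([]=⇒lookup; lookup⇒[]=; lookup∘tabulate)
open import Function using (_∘_)
open import Relation.Binary.PropositionalEquality
open import Relation.Nullary using (Dec; yes; no; does; ¬_; contradiction)
open import Relation.Nullary.Decidable using (_×-dec_; ¬?; map′)

sumFin-cong : ∀ n {f g : Fin n → ℕ} → (∀ i → f i ≡ g i) → sumFin n f ≡ sumFin n g
sumFin-cong zero    f≡g = refl
sumFin-cong (suc n) f≡g = cong₂ _+_ (f≡g zero) (sumFin-cong n (f≡g ∘ suc))

sumFin-mono : ∀ n {f g : Fin n → ℕ} → (∀ i → f i ≤ g i) → sumFin n f ≤ sumFin n g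
sumFin-mono zero    f≤g = z≤n
sumFin-mono (suc n) f≤g = +-mono-≤ (f≤g zero) (sumFin-mono n (f≤g ∘ suc))

sumFin-+ : ∀ n (f g : Fin n → ℕ) → sumFin n (λ i → f i + g i) ≡ sumFin n f + sumFin n g
sumFin-+ zero    f g = refl
sumFin-+ (suc n) f g =
  trans (cong ((f zero + g zero) +_) (sumFin-+ n (f ∘ suc) (g ∘ suc)))
        (+-interchange (f zero) (g zero) (sumFin n (f ∘ suc)) (sumFin n (g ∘ suc)))

sumFin-*ʳ : ∀ n (f : Fin n → ℕ) c → sumFin n (λ i → f i * c) ≡ sumFin n f * c
sumFin-*ʳ zero    f c = refl
sumFin-*ʳ (suc n) f c =
  trans (cong (f zero * c +_) (sumFin-*ʳ n (f ∘ suc) c)) (sym (*-distribʳ-+ c (f zero) _))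

sumFin-0 : ∀ n → sumFin n (λ _ → 0) ≡ 0
sumFin-0 zero    = refl
sumFin-0 (suc n) = sumFin-0 n

sumFin-point : ∀ n (v : Fin n) (f : Fin n → ℕ) →
               sumFin n (λ u → if does (u ≟ᶠ v) then f u else 0) ≡ f v
sumFin-point (suc n) zero    f = trans (cong (f zero +_) (sumFin-0 n)) (+-identityʳ (f zero))
sumFin-point (suc n) (suc v) f = sumFin-point n v (f ∘ suc)

sumFin-mono-< : ∀ n {f g : Fin n → ℕ} (v : Fin n) → (∀ i → f i ≤ g i) → f v < g v →
                sumFin n f < sumFin n g
sumFin-mono-< (suc n) zero    f≤g fv<gv = +-mono-<-≤ fv<gv (sumFin-mono n (f≤g ∘ suc))
sumFin-mono-< (suc n) (suc v) f≤g fv<gv = +-mono-≤-< (f≤g zero) (sumFin-mono-< n v (f≤g ∘ suc) fv<gv)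

weight : ∀ {k} → (Fin k → ℕ) → Subset k → ℕ
weight w []            = 0
weight w (inside  ∷ p) = w zero + weight (w ∘ suc) p
weight w (outside ∷ p) = weight (w ∘ suc) p

∣p∣≡weight1 : ∀ {k} (p : Subset k) → ∣ p ∣ ≡ weight (λ _ → 1) p
∣p∣≡weight1 []            = refl
∣p∣≡weight1 (inside  ∷ p) = cong suc (∣p∣≡weight1 p)
∣p∣≡weight1 (outside ∷ p) = ∣p∣≡weight1 p

weight-mono : ∀ {k} {f g : Fin k → ℕ} (p : Subset k) → (∀ i → f i ≤ g i) → weight f p ≤ weight g p
weight-mono []            f≤g = z≤n
weight-mono (inside  ∷ p) f≤g = +-mono-≤ (f≤g zero) (weight-mono p (f≤g ∘ suc))
weight-mono (outside ∷ p) f≤g = weight-mono p (f≤g ∘ suc)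

weight-mono-< : ∀ {k} {f g : Fin k → ℕ} {c} (p : Subset k) → c ∈ p →
                (∀ i → f i ≤ g i) → f c < g c → weight f p < weight g p
weight-mono-< (inside  ∷ p) here       f≤g fc<gc = +-mono-<-≤ fc<gc (weight-mono p (f≤g ∘ suc))
weight-mono-< (inside  ∷ p) (there c∈p) f≤g fc<gc =
  +-mono-≤-< (f≤g zero) (weight-mono-< p c∈p (f≤g ∘ suc) fc<gc)
weight-mono-< (outside ∷ p) (there c∈p) f≤g fc<gc = weight-mono-< p c∈p (f≤g ∘ suc) fc<gc

weight-+ : ∀ {k} (f g : Fin k → ℕ) (p : Subset k) →
           weight (λ i → f i + g i) p ≡ weight f p + weight g p
weight-+ f g []            = refl
weight-+ f g (inside  ∷ p) =
  trans (cong ((f zero + g zero) +_) (weight-+ (f ∘ suc) (g ∘ suc) p))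
        (+-interchange (f zero) (g zero) (weight (f ∘ suc) p) (weight (g ∘ suc) p))
weight-+ f g (outside ∷ p) = weight-+ (f ∘ suc) (g ∘ suc) p

weight-≤ : ∀ {k} (w : Fin k → ℕ) {K} (p : Subset k) → (∀ i → w i ≤ K) → weight w p ≤ ∣ p ∣ * K
weight-≤ w []            w≤K = z≤n
weight-≤ w (inside  ∷ p) w≤K = +-mono-≤ (w≤K zero) (weight-≤ (w ∘ suc) p (w≤K ∘ suc))
weight-≤ w (outside ∷ p) w≤K = weight-≤ (w ∘ suc) p (w≤K ∘ suc)

weight-⊥ : ∀ {k} (w : Fin k → ℕ) → weight w (⊥ {k}) ≡ 0
weight-⊥ {zero}  w = refl
weight-⊥ {suc k} w = weight-⊥ (w ∘ suc)

weight-⁅⁆ : ∀ {k} (w : Fin k → ℕ) (i : Fin k) → weight w ⁅ i ⁆ ≡ w i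
weight-⁅⁆ w zero    = trans (cong (w zero +_) (weight-⊥ (w ∘ suc))) (+-identityʳ (w zero))
weight-⁅⁆ w (suc i) = weight-⁅⁆ (w ∘ suc) i

weight-∪∩ : ∀ {k} (w : Fin k → ℕ) (p q : Subset k) →
            weight w (p ∪ q) + weight w (p ∩ q) ≡ weight w p + weight w q
weight-∪∩ w []            []            = refl
weight-∪∩ w (inside  ∷ p) (inside  ∷ q) = begin
  (w zero + weight (w ∘ suc) (p ∪ q)) + (w zero + weight (w ∘ suc) (p ∩ q))
    ≡⟨ +-interchange (w zero) _ (w zero) _ ⟩
  (w zero + w zero) + (weight (w ∘ suc) (p ∪ q) + weight (w ∘ suc) (p ∩ q))
    ≡⟨ cong ((w zero + w zero) +_) (weight-∪∩ (w ∘ suc) p q) ⟩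
  (w zero + w zero) + (weight (w ∘ suc) p + weight (w ∘ suc) q)
    ≡⟨ +-interchange (w zero) (w zero) _ _ ⟩
  (w zero + weight (w ∘ suc) p) + (w zero + weight (w ∘ suc) q) ∎
  where open ≡-Reasoning
weight-∪∩ w (inside  ∷ p) (outside ∷ q) =
  trans (+-assoc (w zero) _ _)
        (trans (cong (w zero +_) (weight-∪∩ (w ∘ suc) p q)) (sym (+-assoc (w zero) _ _)))
weight-∪∩ w (outside ∷ p) (inside  ∷ q) =
  trans (+-assoc (w zero) _ _)
        (trans (cong (w zero +_) (weight-∪∩ (w ∘ suc) p q)) (m+[n+o]≡n+[m+o] (w zero) (weight (w ∘ suc) p) _))
weight-∪∩ w (outside ∷ p) (outside ∷ q) = weight-∪∩ (w ∘ suc) p q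

∣p∪q∣+∣p∩q∣≡∣p∣+∣q∣ : ∀ {k} (p q : Subset k) → ∣ p ∪ q ∣ + ∣ p ∩ q ∣ ≡ ∣ p ∣ + ∣ q ∣
∣p∪q∣+∣p∩q∣≡∣p∣+∣q∣ p q = begin
  ∣ p ∪ q ∣ + ∣ p ∩ q ∣                                ≡⟨ cong₂ _+_ (∣p∣≡weight1 (p ∪ q)) (∣p∣≡weight1 (p ∩ q)) ⟩
  weight (λ _ → 1) (p ∪ q) + weight (λ _ → 1) (p ∩ q) ≡⟨ weight-∪∩ (λ _ → 1) p q ⟩
  weight (λ _ → 1) p + weight (λ _ → 1) q             ≡⟨ cong₂ _+_ (∣p∣≡weight1 p) (∣p∣≡weight1 q) ⟨
  ∣ p ∣ + ∣ q ∣                                        ∎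
  where open ≡-Reasoning

∣p∪q∣≤∣p∣+∣q∣ : ∀ {k} (p q : Subset k) → ∣ p ∪ q ∣ ≤ ∣ p ∣ + ∣ q ∣
∣p∪q∣≤∣p∣+∣q∣ p q = ≤-trans (m≤m+n ∣ p ∪ q ∣ ∣ p ∩ q ∣) (≤-reflexive (∣p∪q∣+∣p∩q∣≡∣p∣+∣q∣ p q))

χ : ∀ {k} → Subset k → Fin k → ℕ
χ p i = if does (i ∈? p) then 1 else 0

χ≤1 : ∀ {k} (p : Subset k) i → χ p i ≤ 1
χ≤1 p i with does (i ∈? p)
... | true  = ≤-refl
... | false = z≤n

χ-mono : ∀ {k} {p q : Subset k} {i} → (i ∈ p → i ∈ q) → χ p i ≤ χ q i
χ-mono {p = p} {q} {i} p⇒q with i ∈? p | i ∈? q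
... | yes i∈p | no  i∉q = contradiction (p⇒q i∈p) i∉q
... | yes _   | yes _   = ≤-refl
... | no  _   | _       = z≤n

∣q∩p∣≡weight-χ : ∀ {k} (q p : Subset k) → ∣ q ∩ p ∣ ≡ weight (χ q) p
∣q∩p∣≡weight-χ []            []            = refl
∣q∩p∣≡weight-χ (inside  ∷ q) (inside  ∷ p) = cong suc (∣q∩p∣≡weight-χ q p)
∣q∩p∣≡weight-χ (outside ∷ q) (inside  ∷ p) = ∣q∩p∣≡weight-χ q p
∣q∩p∣≡weight-χ (inside  ∷ q) (outside ∷ p) = ∣q∩p∣≡weight-χ q p
∣q∩p∣≡weight-χ (outside ∷ q) (outside ∷ p) = ∣q∩p∣≡weight-χ q p

sumFinℤ-cong : ∀ k {f g : Fin k → ℤ} → (∀ i → f i ≡ g i) → sumFinℤ k f ≡ sumFinℤ k g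
sumFinℤ-cong zero    f≗g = refl
sumFinℤ-cong (suc k) f≗g = cong₂ ℤ._+_ (f≗g zero) (sumFinℤ-cong k (f≗g ∘ suc))

sumFinℤ-pos : ∀ k (f : Fin k → ℕ) → sumFinℤ k (ℤ.+_ ∘ f) ≡ ℤ.+ sumFin k f
sumFinℤ-pos zero    f = refl
sumFinℤ-pos (suc k) f = trans (cong (ℤ._+_ (ℤ.+ f zero)) (sumFinℤ-pos k (f ∘ suc))) (sym (ℤP.pos-+ (f zero) _))

sumFinℤ-weight : ∀ {k} (w : Fin k → ℕ) (p : Subset k) →
                 sumFinℤ k (λ i → if does (i ∈? p) then ℤ.+ w i else ℤ.+ 0) ≡ ℤ.+ weight w p
sumFinℤ-weight w []            = refl
sumFinℤ-weight w (inside  ∷ p) =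
  trans (cong (ℤ._+_ (ℤ.+ w zero)) (sumFinℤ-weight (w ∘ suc) p)) (sym (ℤP.pos-+ (w zero) _))
sumFinℤ-weight w (outside ∷ p) = trans (ℤP.+-identityˡ _) (sumFinℤ-weight (w ∘ suc) p)

∈⟦⟧⁻ : ∀ {k} {P : Fin k → Set} (P? : ∀ x → Dec (P x)) {x} → x ∈ ⟦ P? ⟧ → P x
∈⟦⟧⁻ P? {x} x∈ with P? x | trans (sym (lookup∘tabulate (does ∘ P?) x)) ([]=⇒lookup x∈)
... | yes px | _ = px

∈⟦⟧⁺ : ∀ {k} {P : Fin k → Set} (P? : ∀ x → Dec (P x)) {x} → P x → x ∈ ⟦ P? ⟧
∈⟦⟧⁺ P? {x} px = lookup⇒[]= x _ (trans (lookup∘tabulate (does ∘ P?) x) (does-yes (P? x)))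
  where does-yes : (d : Dec _) → does d ≡ true
        does-yes (yes _)  = refl
        does-yes (no ¬px) = contradiction px ¬px

x∈p─q⇒x∉q : ∀ {k} {x : Fin k} {p q : Subset k} → x ∈ p ─ q → x ∉ q
x∈p─q⇒x∉q {p = _ ∷ p} {inside  ∷ q} ()           here
x∈p─q⇒x∉q {p = _ ∷ p} {_       ∷ q} (there x∈p─q) (there x∈q) = x∈p─q⇒x∉q x∈p─q x∈q

x∈p-y⇒x≢y : ∀ {k} {x y : Fin k} {p : Subset k} → x ∈ p - y → x ≢ y
x∈p-y⇒x≢y {y = y} x∈p-y refl = x∈p─q⇒x∉q x∈p-y (x∈⁅x⁆ y)

∣p∣≡1⇒Nonempty : ∀ {k} (p : Subset k) → ∣ p ∣ ≡ 1 → Nonempty p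
∣p∣≡1⇒Nonempty {k} p ∣p∣≡1 with nonempty? p
... | yes ne = ne
... | no  ¬ne = contradiction (trans (sym ∣p∣≡1) (trans (cong ∣_∣ (Empty-unique ¬ne)) (∣⊥∣≡0 k))) λ ()

∣p∣≡1⇒x≡y : ∀ {k} {p : Subset k} {x y} → ∣ p ∣ ≡ 1 → x ∈ p → y ∈ p → x ≡ y
∣p∣≡1⇒x≡y {p = p} {x} {y} ∣p∣≡1 x∈p y∈p with x ≟ᶠ y
... | yes x≡y = x≡y
... | no  x≢y = contradiction 1<1 (<-irrefl refl)
  where
  ⁅y⁆⊆p-x : ⁅ y ⁆ ⊆ p - x
  ⁅y⁆⊆p-x z∈⁅y⁆ rewrite x∈⁅y⁆⇒x≡y y z∈⁅y⁆ = x∈p∧x≢y⇒x∈p-y y∈p (x≢y ∘ sym)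

  open ≤-Reasoning
  1<1 : 1 < 1
  1<1 = begin-strict
    1          ≡⟨ sym (∣⁅x⁆∣≡1 y) ⟩
    ∣ ⁅ y ⁆ ∣  ≤⟨ p⊆q⇒∣p∣≤∣q∣ ⁅y⁆⊆p-x ⟩
    ∣ p - x ∣  <⟨ x∈p⇒∣p-x∣<∣p∣ x∈p ⟩
    ∣ p ∣      ≡⟨ ∣p∣≡1 ⟩
    1          ∎

range : ∀ {k n} → (Fin k → Fin n) → Subset n
range f = ⟦ (λ w → any? (λ h → f h ≟ᶠ w)) ⟧

∣range∣≤ : ∀ k {n} (f : Fin k → Fin n) → ∣ range f ∣ ≤ k
∣range∣≤ zero    {n} f = ≤-trans (p⊆q⇒∣p∣≤∣q∣ range⊆⊥) (≤-reflexive (∣⊥∣≡0 n))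
  where range⊆⊥ : range f ⊆ ⊥
        range⊆⊥ w∈ with ∈⟦⟧⁻ (λ w → any? (λ h → f h ≟ᶠ w)) w∈
        ... | () , _
∣range∣≤ (suc k) {n} f = begin
  ∣ range f ∣                          ≤⟨ p⊆q⇒∣p∣≤∣q∣ range⊆ ⟩
  ∣ ⁅ f zero ⁆ ∪ range (f ∘ suc) ∣      ≤⟨ ∣p∪q∣≤∣p∣+∣q∣ ⁅ f zero ⁆ (range (f ∘ suc)) ⟩
  ∣ ⁅ f zero ⁆ ∣ + ∣ range (f ∘ suc) ∣  ≤⟨ +-mono-≤ (≤-reflexive (∣⁅x⁆∣≡1 (f zero))) (∣range∣≤ k (f ∘ suc)) ⟩
  suc k                                ∎
  where
  open ≤-Reasoning
  range⊆ : range f ⊆ ⁅ f zero ⁆ ∪ range (f ∘ suc)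
  range⊆ w∈ with ∈⟦⟧⁻ (λ w → any? (λ h → f h ≟ᶠ w)) w∈
  ... | zero  , refl = x∈p∪q⁺ (inj₁ (x∈⁅x⁆ (f zero)))
  ... | suc h , refl = x∈p∪q⁺ (inj₂ (∈⟦⟧⁺ (λ w → any? (λ h → f (suc h) ≟ᶠ w)) (h , refl)))

module _ {n t : ℕ} where

  infixr 6 _∪ₚ_
  infixr 7 _∩ₚ_

  _∪ₚ_ : PairSet n t → PairSet n t → PairSet n t
  (X ∪ₚ Y) v = X v ∪ Y v

  _∩ₚ_ : PairSet n t → PairSet n t → PairSet n t
  (X ∩ₚ Y) v = X v ∩ Y v

  ∅ₚ : PairSet n t
  ∅ₚ v = ⊥

  ⁅_,_⁆ₚ : Fin n → Fin t → PairSet n t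
  ⁅ v , c ⁆ₚ u = if does (u ≟ᶠ v) then ⁅ c ⁆ else ⊥

  ⋃ₚ : ∀ {k} → (Fin k → PairSet n t) → PairSet n t
  ⋃ₚ {zero}  F = ∅ₚ
  ⋃ₚ {suc k} F = F zero ∪ₚ ⋃ₚ (F ∘ suc)

  ∈⁅,⁆ₚ : ∀ v c → c ∈ ⁅ v , c ⁆ₚ v
  ∈⁅,⁆ₚ v c with v ≟ᶠ v
  ... | yes _   = x∈⁅x⁆ c
  ... | no  v≢v = contradiction refl v≢v

  ∈⁅,⁆ₚ⁻ : ∀ v c {u i} → i ∈ ⁅ v , c ⁆ₚ u → u ≡ v × i ≡ c
  ∈⁅,⁆ₚ⁻ v c {u} i∈ with u ≟ᶠ v
  ... | yes u≡v = u≡v , x∈⁅y⁆⇒x≡y c i∈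
  ... | no  _   = contradiction i∈ ∉⊥

  ∈⋃ₚ⁺ : ∀ {k} (F : Fin k → PairSet n t) j {v i} → i ∈ F j v → i ∈ ⋃ₚ F v
  ∈⋃ₚ⁺ F zero    i∈ = x∈p∪q⁺ (inj₁ i∈)
  ∈⋃ₚ⁺ F (suc j) i∈ = x∈p∪q⁺ (inj₂ (∈⋃ₚ⁺ (F ∘ suc) j i∈))

  ⋃ₚ-closed : ∀ {k} (Q : PairSet n t → Set) → Q ∅ₚ → (∀ {X Y} → Q X → Q Y → Q (X ∪ₚ Y)) →
              (F : Fin k → PairSet n t) → (∀ j → Q (F j)) → Q (⋃ₚ F)
  ⋃ₚ-closed {zero}  Q Q∅ Q∪ F QF = Q∅
  ⋃ₚ-closed {suc k} Q Q∅ Q∪ F QF = Q∪ (QF zero) (⋃ₚ-closed Q Q∅ Q∪ (F ∘ suc) (QF ∘ suc))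

  weightₚ : (Fin n → Fin t → ℕ) → PairSet n t → ℕ
  weightₚ w X = sumFin n (λ v → weight (w v) (X v))

  ∣X∣ₚ≡weightₚ1 : ∀ X → ∣ X ∣ₚ ≡ weightₚ (λ _ _ → 1) X
  ∣X∣ₚ≡weightₚ1 X = sumFin-cong n (∣p∣≡weight1 ∘ X)

  weightₚ-cong : ∀ w {X Y} → (∀ v → X v ≡ Y v) → weightₚ w X ≡ weightₚ w Y
  weightₚ-cong w X≗Y = sumFin-cong n (λ v → cong (weight (w v)) (X≗Y v))

  weightₚ-mono : ∀ {f g} X → (∀ v i → f v i ≤ g v i) → weightₚ f X ≤ weightₚ g X
  weightₚ-mono X f≤g = sumFin-mono n (λ v → weight-mono (X v) (f≤g v))

  weightₚ-mono-< : ∀ {f g v c} X → c ∈ X v → (∀ u i → f u i ≤ g u i) → f v c < g v c →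
                   weightₚ f X < weightₚ g X
  weightₚ-mono-< {v = v} X c∈ f≤g fvc<gvc =
    sumFin-mono-< n v (λ u → weight-mono (X u) (f≤g u)) (weight-mono-< (X v) c∈ (f≤g v) fvc<gvc)

  weightₚ-∪∩ : ∀ w X Y → weightₚ w (X ∪ₚ Y) + weightₚ w (X ∩ₚ Y) ≡ weightₚ w X + weightₚ w Y
  weightₚ-∪∩ w X Y = begin
    weightₚ w (X ∪ₚ Y) + weightₚ w (X ∩ₚ Y)
      ≡⟨ sumFin-+ n _ _ ⟨
    sumFin n (λ v → weight (w v) (X v ∪ Y v) + weight (w v) (X v ∩ Y v))
      ≡⟨ sumFin-cong n (λ v → weight-∪∩ (w v) (X v) (Y v)) ⟩
    sumFin n (λ v → weight (w v) (X v) + weight (w v) (Y v))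
      ≡⟨ sumFin-+ n _ _ ⟩
    weightₚ w X + weightₚ w Y ∎
    where open ≡-Reasoning

  weightₚ-≤ : ∀ w {K} X → (∀ v i → w v i ≤ K) → weightₚ w X ≤ ∣ X ∣ₚ * K
  weightₚ-≤ w {K} X w≤K = ≤-trans (sumFin-mono n (λ v → weight-≤ (w v) (X v) (w≤K v)))
                                  (≤-reflexive (sumFin-*ʳ n (λ v → ∣ X v ∣) K))

  weightₚ-⁅,⁆ₚ : ∀ w v c → weightₚ w ⁅ v , c ⁆ₚ ≡ w v c
  weightₚ-⁅,⁆ₚ w v c = trans (sumFin-cong n weight-at) (sumFin-point n v (λ u → w u c))
    where weight-at : ∀ u → weight (w u) (⁅ v , c ⁆ₚ u) ≡ (if does (u ≟ᶠ v) then w u c else 0)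
          weight-at u with u ≟ᶠ v
          ... | yes _ = weight-⁅⁆ (w u) c
          ... | no  _ = weight-⊥ (w u)

  weightₚ-∪⁅,⁆ₚ : ∀ w {v c} X → c ∉ X v → weightₚ w (X ∪ₚ ⁅ v , c ⁆ₚ) ≡ weightₚ w X + w v c
  weightₚ-∪⁅,⁆ₚ w {v} {c} X c∉ = begin
    weightₚ w (X ∪ₚ ⁅ v , c ⁆ₚ)
      ≡⟨ +-identityʳ _ ⟨
    weightₚ w (X ∪ₚ ⁅ v , c ⁆ₚ) + 0
      ≡⟨ cong (weightₚ w (X ∪ₚ ⁅ v , c ⁆ₚ) +_) disjoint ⟨
    weightₚ w (X ∪ₚ ⁅ v , c ⁆ₚ) + weightₚ w (X ∩ₚ ⁅ v , c ⁆ₚ)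
      ≡⟨ weightₚ-∪∩ w X ⁅ v , c ⁆ₚ ⟩
    weightₚ w X + weightₚ w ⁅ v , c ⁆ₚ
      ≡⟨ cong (weightₚ w X +_) (weightₚ-⁅,⁆ₚ w v c) ⟩
    weightₚ w X + w v c ∎
    where
    open ≡-Reasoning
    X∩⁅,⁆ₚ≡⊥ : ∀ u → X u ∩ ⁅ v , c ⁆ₚ u ≡ ⊥
    X∩⁅,⁆ₚ≡⊥ u = Empty-unique λ (i , i∈) → not-both (x∈p∩q⁻ (X u) (⁅ v , c ⁆ₚ u) i∈)
      where not-both : ∀ {i} → ¬ (i ∈ X u × i ∈ ⁅ v , c ⁆ₚ u)
            not-both (i∈X , i∈⁅⁆) with ∈⁅,⁆ₚ⁻ v c {u} i∈⁅⁆
            ... | refl , refl = c∉ i∈X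
    disjoint : weightₚ w (X ∩ₚ ⁅ v , c ⁆ₚ) ≡ 0
    disjoint = trans (sumFin-cong n (λ u → trans (cong (weight (w u)) (X∩⁅,⁆ₚ≡⊥ u)) (weight-⊥ (w u))))
                     (sumFin-0 n)

  ∣X∪Y∣ₚ≤∣X∣ₚ+∣Y∣ₚ : ∀ X Y → ∣ X ∪ₚ Y ∣ₚ ≤ ∣ X ∣ₚ + ∣ Y ∣ₚ
  ∣X∪Y∣ₚ≤∣X∣ₚ+∣Y∣ₚ X Y = ≤-trans (sumFin-mono n (λ v → ∣p∪q∣≤∣p∣+∣q∣ (X v) (Y v)))
                                (≤-reflexive (sumFin-+ n (λ v → ∣ X v ∣) (λ v → ∣ Y v ∣)))

  ∣X∩Y∣ₚ≤∣X∣ₚ : ∀ X Y → ∣ X ∩ₚ Y ∣ₚ ≤ ∣ X ∣ₚ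
  ∣X∩Y∣ₚ≤∣X∣ₚ X Y = sumFin-mono n (λ v → ∣p∩q∣≤∣p∣ (X v) (Y v))

  ∣∅ₚ∣ₚ≡0 : ∣ ∅ₚ ∣ₚ ≡ 0
  ∣∅ₚ∣ₚ≡0 = trans (sumFin-cong n (λ _ → ∣⊥∣≡0 t)) (sumFin-0 n)

  ∣⁅,⁆ₚ∣ₚ≡1 : ∀ v c → ∣ ⁅ v , c ⁆ₚ ∣ₚ ≡ 1
  ∣⁅,⁆ₚ∣ₚ≡1 v c = trans (∣X∣ₚ≡weightₚ1 ⁅ v , c ⁆ₚ) (weightₚ-⁅,⁆ₚ (λ _ _ → 1) v c)

Searchable : Set → Set₁
Searchable A = ∀ {Q : A → Set} → (∀ a → Dec (Q a)) → Dec (∃ Q)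

anyFun? : ∀ {A} → Searchable A → ∀ n {Q : (Fin n → A) → Set} →
          (∀ {f g} → (∀ i → f i ≡ g i) → Q f → Q g) → (∀ f → Dec (Q f)) → Dec (∃ Q)
anyFun? search zero    Q-resp Q? =
  map′ (λ q → []ᶠ , q) (λ (f , q) → Q-resp {f} (λ ()) q) (Q? []ᶠ)
anyFun? search (suc n) Q-resp Q? =
  map′ (λ (a , g , q) → a ∷ᶠ g , q)
       (λ (f , q) → f zero , f ∘ suc , Q-resp (λ { zero → refl ; (suc i) → refl }) q)
       (search λ a → anyFun? search n (λ g≗h → Q-resp (λ { zero → refl ; (suc i) → g≗h i }))
                                       (λ g → Q? (a ∷ᶠ g)))

anyPairSet? : ∀ {n t} {Q : PairSet n t → Set} →
              (∀ {X Y} → (∀ v → X v ≡ Y v) → Q X → Q Y) → (∀ X → Dec (Q X)) → Dec (∃ Q)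
anyPairSet? {n} = anyFun? anySubset? n

∃⊎∀ : ∀ {n} {P Q : Fin n → Set} → (∀ x → P x ⊎ Q x) → ∃ P ⊎ (∀ x → Q x)
∃⊎∀ {zero}  P⊎Q = inj₂ λ ()
∃⊎∀ {suc n} P⊎Q with P⊎Q zero | ∃⊎∀ (P⊎Q ∘ suc)
... | inj₁ p | _          = inj₁ (zero , p)
... | inj₂ _ | inj₁ (x , p) = inj₁ (suc x , p)
... | inj₂ q | inj₂ q′    = inj₂ λ { zero → q ; (suc x) → q′ x }

module _ {t n : ℕ} (𝒢 : GraphFamily t n) where

  private
    Γ? : ∀ (X : PairSet n t) w → Dec (∃[ v ] ∃[ i ] (i ∈ X v × w ∈ adj 𝒢 i v))
    Γ? X w = any? λ v → any? λ i → (i ∈? X v) ×-dec (w ∈? adj 𝒢 i v)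

  ∈Γ⁺ : ∀ X {w} v i → i ∈ X v → w ∈ adj 𝒢 i v → w ∈ Γ 𝒢 X
  ∈Γ⁺ X v i i∈ w∈ = ∈⟦⟧⁺ (Γ? X) (v , i , i∈ , w∈)

  ∈Γ⁻ : ∀ X {w} → w ∈ Γ 𝒢 X → ∃[ v ] ∃[ i ] (i ∈ X v × w ∈ adj 𝒢 i v)
  ∈Γ⁻ X = ∈⟦⟧⁻ (Γ? X)

  Γ-mono : ∀ {X Y} → (∀ v → X v ⊆ Y v) → Γ 𝒢 X ⊆ Γ 𝒢 Y
  Γ-mono {X} {Y} X⊆Y w∈ with ∈Γ⁻ X w∈
  ... | v , i , i∈ , w∈adj = ∈Γ⁺ Y v i (X⊆Y v i∈) w∈adj

  Γ-cong : ∀ {X Y} → (∀ v → X v ≡ Y v) → Γ 𝒢 X ≡ Γ 𝒢 Y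
  Γ-cong X≗Y = ⊆-antisym (Γ-mono (⊆-reflexive ∘ X≗Y)) (Γ-mono (⊆-reflexive ∘ sym ∘ X≗Y))

≡just⇒≢nothing : ∀ {A : Set} {x : Maybe A} {a} → x ≡ just a → ¬ x ≡ nothing
≡just⇒≢nothing refl ()

module _ {t m : ℕ} (H : ColGraph t m) where

  private
    edge? : ∀ S i h y → Dec (y ∈ S × col H h y ≡ just i)
    edge? S i h y = (y ∈? S) ×-dec (≡-dec _≟ᶠ_ (col H h y) (just i))

    adjacent? : ∀ S h y → Dec (y ∈ S × ¬ col H h y ≡ nothing)
    adjacent? S h y = (y ∈? S) ×-dec ¬? (≡-dec _≟ᶠ_ (col H h y) nothing)

  degIn-mono : ∀ {S₁ S₂} → S₁ ⊆ S₂ → ∀ i h → degIn H S₁ i h ≤ degIn H S₂ i h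
  degIn-mono {S₁} {S₂} S₁⊆S₂ i h = p⊆q⇒∣p∣≤∣q∣ λ y∈ →
    let (y∈S₁ , hy) = ∈⟦⟧⁻ (edge? S₁ i h) y∈ in ∈⟦⟧⁺ (edge? S₂ i h) (S₁⊆S₂ y∈S₁ , hy)

  degIn-< : ∀ {S₁ S₂ z i h} → S₁ ⊆ S₂ → z ∈ S₂ → z ∉ S₁ → col H h z ≡ just i →
            degIn H S₁ i h < degIn H S₂ i h
  degIn-< {S₁} {S₂} {z} {i} {h} S₁⊆S₂ z∈S₂ z∉S₁ hz = begin-strict
    degIn H S₁ i h         ≤⟨ p⊆q⇒∣p∣≤∣q∣ S₁-edges⊆ ⟩
    ∣ ⟦ edge? S₂ i h ⟧ - z ∣ <⟨ x∈p⇒∣p-x∣<∣p∣ (∈⟦⟧⁺ (edge? S₂ i h) (z∈S₂ , hz)) ⟩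
    degIn H S₂ i h         ∎
    where
    open ≤-Reasoning
    S₁-edges⊆ : ⟦ edge? S₁ i h ⟧ ⊆ ⟦ edge? S₂ i h ⟧ - z
    S₁-edges⊆ y∈ = let (y∈S₁ , hy) = ∈⟦⟧⁻ (edge? S₁ i h) y∈ in
      x∈p∧x≢y⇒x∈p-y (∈⟦⟧⁺ (edge? S₂ i h) (S₁⊆S₂ y∈S₁ , hy)) λ { refl → z∉S₁ y∈S₁ }

  leaf-neighbour : ∀ {S ℓ} → degAllIn H S ℓ ≡ 1 → ∃[ p ] ∃[ c ] (p ∈ S × col H ℓ p ≡ just c)
  leaf-neighbour {S} {ℓ} deg≡1 with ∣p∣≡1⇒Nonempty _ deg≡1
  ... | p , p∈ with ∈⟦⟧⁻ (adjacent? S ℓ) p∈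
  ...   | p∈S , ℓp≢nothing with col H ℓ p in ℓp
  ...     | just c  = p , c , p∈S , ℓp
  ...     | nothing = contradiction refl ℓp≢nothing

  leaf-neighbour-unique : ∀ {S ℓ y z a b} → degAllIn H S ℓ ≡ 1 →
                          y ∈ S → col H ℓ y ≡ just a → z ∈ S → col H ℓ z ≡ just b → y ≡ z
  leaf-neighbour-unique {S} {ℓ} deg≡1 y∈S ℓy z∈S ℓz =
    ∣p∣≡1⇒x≡y deg≡1 (∈⟦⟧⁺ (adjacent? S ℓ) (y∈S , ≡just⇒≢nothing ℓy))
                    (∈⟦⟧⁺ (adjacent? S ℓ) (z∈S , ≡just⇒≢nothing ℓz))

module _ {t m : ℕ} {H : ColGraph t m} (ρ : Rooted H) where

  RootPathsIn : Subset m → Set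
  RootPathsIn S = ∀ {h ys} → h ∈ S → RootPath H (roots ρ) h ys → All (_∈ S) ys

  -- Entering the non-root leaf ℓ from h, a root path would have to leave it through a
  -- second neighbour.
  root-walk-avoids-leaf : ∀ {S ℓ} → NonRootLeafIn ρ S ℓ → ∀ {h ys} →
                          RootWalk H (roots ρ) h ys → Unique (h ∷ ys) →
                          h ∈ S → h ≢ ℓ → All (_∈ S) ys → All (_≢ ℓ) ys
  root-walk-avoids-leaf leaf (stop _) _ _ _ [] = []
  root-walk-avoids-leaf {S} {ℓ} leaf@(_ , ℓ∉R , deg≡1) {h} (step {y = y} _ _ hy walk)
                        (h∉ys ∷ unique) h∈S h≢ℓ (y∈S ∷ ys∈S) with y ≟ᶠ ℓ
  ... | no  y≢ℓ = y≢ℓ ∷ root-walk-avoids-leaf leaf walk unique y∈S y≢ℓ ys∈S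
  ... | yes refl = contradiction (walk , h∉ys , ys∈S) no-exit
    where
    no-exit : ∀ {zs} → ¬ (RootWalk H (roots ρ) ℓ zs × All (h ≢_) (ℓ ∷ zs) × All (_∈ S) zs)
    no-exit (stop ℓ∈R , _) = ℓ∉R ℓ∈R
    no-exit (step _ _ ℓz _ , (_ ∷ h≢z ∷ _) , (z∈S ∷ _)) =
      h≢z (leaf-neighbour-unique H deg≡1 h∈S (trans (ColGraph.sym H ℓ h) hy) z∈S ℓz)

  LeafRemoved⇒RootPathsIn : ∀ {S} → LeafRemoved ρ S → RootPathsIn S
  LeafRemoved⇒RootPathsIn start                      {ys = ys} _   _ = universal (λ _ → ∈⊤) ys
  LeafRemoved⇒RootPathsIn (remove {S} {ℓ} removed leaf) {ys = ys} h∈S-ℓ path@(walk , unique) =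
    All-∈-ℓ ys∈S (root-walk-avoids-leaf leaf walk unique (p─q⊆p S ⁅ ℓ ⁆ h∈S-ℓ) (x∈p-y⇒x≢y h∈S-ℓ) ys∈S)
    where
    ys∈S : All (_∈ S) ys
    ys∈S = LeafRemoved⇒RootPathsIn removed (p─q⊆p S ⁅ ℓ ⁆ h∈S-ℓ) path
    All-∈-ℓ : ∀ {zs} → All (_∈ S) zs → All (_≢ ℓ) zs → All (_∈ S - ℓ) zs
    All-∈-ℓ []           []           = []
    All-∈-ℓ (z∈S ∷ zs∈S) (z≢ℓ ∷ zs≢ℓ) = x∈p∧x≢y⇒x∈p-y z∈S z≢ℓ ∷ All-∈-ℓ zs∈S zs≢ℓ

  parentColour-leaf : ∀ {S ℓ p c} → LeafRemoved ρ S → NonRootLeafIn ρ S ℓ →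
                      p ∈ S → col H ℓ p ≡ just c → parentColour ρ ℓ ≡ just c
  parentColour-leaf {S} {ℓ} {p} {c} removed (ℓ∈S , ℓ∉R , deg≡1) p∈S ℓp with ℓ ∈? roots ρ
  ... | yes ℓ∈R = contradiction ℓ∈R ℓ∉R
  ... | no  ℓ∉R′ with paths ρ ℓ ℓ∉R′
  ...   | _ , (walk , unique) , _ = cong just (first-edge walk unique)
    where
    first-edge : ∀ {ys} (walk : RootWalk H (roots ρ) ℓ ys) → Unique (ℓ ∷ ys) → firstColour H walk ℓ∉R′ ≡ c
    first-edge (stop ℓ∈R) _ = contradiction ℓ∈R ℓ∉R
    first-edge walk@(step _ _ ℓy _) unique
      with LeafRemoved⇒RootPathsIn removed ℓ∈S (walk , unique)
    ... | y∈S ∷ _ with leaf-neighbour-unique H deg≡1 y∈S ℓy p∈S ℓp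
    ...   | refl = just-injective (trans (sym ℓy) ℓp)

module Surplus {t m n : ℕ} {H : ColGraph t m} (ρ : Rooted H) (𝒢 : GraphFamily t n)
               (D : ℕ) (S : Subset m) (φ : Fin m → Fin n) where

  private
    image? : ∀ w → Dec (∃[ h ] (h ∈ S × φ h ≡ w))
    image? w = any? λ h → (h ∈? S) ×-dec (φ h ≟ᶠ w)

    P? : ∀ v i → Dec (∃[ h ] (h ∈ S × φ h ≡ v × parentColour ρ h ≡ just i))
    P? v i = any? λ h → (h ∈? S) ×-dec ((φ h ≟ᶠ v) ×-dec (≡-dec _≟ᶠ_ (parentColour ρ h) (just i)))

  Im : Subset n
  Im = image ρ 𝒢 S φ

  ∈image⁺ : ∀ {h w} → h ∈ S → φ h ≡ w → w ∈ Im
  ∈image⁺ h∈S φh≡w = ∈⟦⟧⁺ image? (_ , h∈S , φh≡w)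

  ∈image⁻ : ∀ {w} → w ∈ Im → ∃[ h ] (h ∈ S × φ h ≡ w)
  ∈image⁻ = ∈⟦⟧⁻ image?

  ∈P⁺ : ∀ {h v i} → h ∈ S → φ h ≡ v → parentColour ρ h ≡ just i → i ∈ P ρ 𝒢 S φ v
  ∈P⁺ h∈S φh≡v colour = ∈⟦⟧⁺ (P? _) (_ , h∈S , φh≡v , colour)

  ∈P⁻ : ∀ {v i} → i ∈ P ρ 𝒢 S φ v → ∃[ h ] (h ∈ S × φ h ≡ v × parentColour ρ h ≡ just i)
  ∈P⁻ = ∈⟦⟧⁻ (P? _)

  ∣Im∣≤m : ∣ Im ∣ ≤ m
  ∣Im∣≤m = ≤-trans (p⊆q⇒∣p∣≤∣q∣ Im⊆range) (∣range∣≤ m φ)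
    where Im⊆range : Im ⊆ range φ
          Im⊆range w∈ = let (h , _ , φh≡w) = ∈image⁻ w∈ in ∈⟦⟧⁺ (λ w → any? (λ h → φ h ≟ᶠ w)) (h , φh≡w)

  degAt-φ : (∀ x y → x ∈ S → y ∈ S → φ x ≡ φ y → x ≡ y) →
            ∀ {h} i → h ∈ S → degAt ρ 𝒢 S φ i (φ h) ≡ degIn H S i h
  degAt-φ injective {h} i h∈S with image? (φ h)
  ... | yes (h′ , h′∈S , φh′≡φh) = cong (degIn H S i) (injective h′ h h′∈S h∈S φh′≡φh)
  ... | no  ∉image = contradiction (h , h∈S , refl) ∉image

  degAt-∉Im : ∀ {w} i → w ∉ Im → degAt ρ 𝒢 S φ i w ≡ 0
  degAt-∉Im {w} i w∉Im with image? w
  ... | yes (h , h∈S , φh≡w) = contradiction (∈image⁺ h∈S φh≡w) w∉Im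
  ... | no  _ = refl

  degAt≤ : MaxMonDeg≤ H D → ∀ i w → degAt ρ 𝒢 S φ i w ≤ D
  degAt≤ maxDeg i w with preimage ρ 𝒢 S φ w
  ... | just h  = ≤-trans (degIn-mono H (λ _ → ∈⊤) i h) (maxDeg i h)
  ... | nothing = z≤n

  free : PairSet n t → ℕ
  free X = ∣ Γ 𝒢 X ─ Im ∣

  load : Fin n → Fin t → ℕ
  load v i = (D ∸ degAt ρ 𝒢 S φ i v) + χ (P ρ 𝒢 S φ v) i

  demand : PairSet n t → ℕ
  demand = weightₚ load

  Critical : PairSet n t → Set
  Critical X = free X ≤ demand X

  Goodℕ : ℕ → Set
  Goodℕ s = ∀ X → ∣ X ∣ₚ ≤ 2 * s → demand X ≤ free X

  Violation : ℕ → PairSet n t → Set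
  Violation s X = ∣ X ∣ₚ ≤ 2 * s × free X < demand X

  violation? : ∀ s → Dec (∃ (Violation s))
  violation? s = anyPairSet? Violation-resp (λ X → (∣ X ∣ₚ ≤? 2 * s) ×-dec (free X <? demand X))
    where
    Violation-resp : ∀ {X Y} → (∀ v → X v ≡ Y v) → Violation s X → Violation s Y
    Violation-resp X≗Y (∣X∣≤2s , free<demand) =
      subst (_≤ 2 * s) (sumFin-cong n (cong ∣_∣ ∘ X≗Y)) ∣X∣≤2s ,
      subst₂ _<_ (cong (∣_∣ ∘ (_─ Im)) (Γ-cong 𝒢 X≗Y)) (weightₚ-cong load X≗Y) free<demand

  ¬violation⇒Goodℕ : ∀ s → ¬ ∃ (Violation s) → Goodℕ s
  ¬violation⇒Goodℕ s ¬violation X ∣X∣≤2s = ≮⇒≥ λ free<demand → ¬violation (X , ∣X∣≤2s , free<demand)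

  Rval≡free-demand : MaxMonDeg≤ H D → ∀ X → Rval ρ 𝒢 S φ D X ≡ ℤ.+ free X ℤ.- ℤ.+ demand X
  Rval≡free-demand maxDeg X = begin
    ℤ.+ free X ℤ.- B ℤ.- ℤ.+ C
      ≡⟨ cong (λ b → ℤ.+ free X ℤ.- b ℤ.- ℤ.+ C) B≡ ⟩
    ℤ.+ free X ℤ.- ℤ.+ B′ ℤ.- ℤ.+ C
      ≡⟨ ℤP.+-assoc (ℤ.+ free X) (ℤ.- ℤ.+ B′) (ℤ.- ℤ.+ C) ⟩
    ℤ.+ free X ℤ.+ (ℤ.- ℤ.+ B′ ℤ.- ℤ.+ C)
      ≡⟨ cong (ℤ._+_ (ℤ.+ free X)) (ℤP.neg-distrib-+ (ℤ.+ B′) (ℤ.+ C)) ⟨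
    ℤ.+ free X ℤ.- (ℤ.+ B′ ℤ.+ ℤ.+ C)
      ≡⟨ cong (ℤ._-_ (ℤ.+ free X)) (ℤP.pos-+ B′ C) ⟨
    ℤ.+ free X ℤ.- ℤ.+ (B′ + C)
      ≡⟨ cong (λ d → ℤ.+ free X ℤ.- ℤ.+ d) B′+C≡demand ⟩
    ℤ.+ free X ℤ.- ℤ.+ demand X ∎
    where
    open ≡-Reasoning
    B : ℤ
    B = sumFinℤ n (λ v → sumFinℤ t (λ i →
          if does (i ∈? X v) then ℤ.+ D ℤ.- ℤ.+ degAt ρ 𝒢 S φ i v else ℤ.+ 0))
    C : ℕ
    C = sumFin n (λ v → ∣ P ρ 𝒢 S φ v ∩ X v ∣)

    B′ : ℕ
    B′ = weightₚ (λ v i → D ∸ degAt ρ 𝒢 S φ i v) X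

    D-deg : ∀ v i b → (if b then ℤ.+ D ℤ.- ℤ.+ degAt ρ 𝒢 S φ i v else ℤ.+ 0)
                    ≡ (if b then ℤ.+ (D ∸ degAt ρ 𝒢 S φ i v) else ℤ.+ 0)
    D-deg v i false = refl
    D-deg v i true  = trans (ℤP.[+m]-[+n]≡m⊖n D (degAt ρ 𝒢 S φ i v)) (ℤP.⊖-≥ (degAt≤ maxDeg i v))

    B≡ : B ≡ ℤ.+ B′
    B≡ = trans (sumFinℤ-cong n λ v → trans (sumFinℤ-cong t λ i → D-deg v i (does (i ∈? X v)))
                                           (sumFinℤ-weight (λ i → D ∸ degAt ρ 𝒢 S φ i v) (X v)))
               (sumFinℤ-pos n _)

    B′+C≡demand : B′ + C ≡ demand X
    B′+C≡demand = begin
      B′ + C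
        ≡⟨ cong (B′ +_) (sumFin-cong n λ v → ∣q∩p∣≡weight-χ (P ρ 𝒢 S φ v) (X v)) ⟩
      B′ + weightₚ (λ v → χ (P ρ 𝒢 S φ v)) X
        ≡⟨ sumFin-+ n _ _ ⟨
      sumFin n (λ v → weight (λ i → D ∸ degAt ρ 𝒢 S φ i v) (X v) + weight (χ (P ρ 𝒢 S φ v)) (X v))
        ≡⟨ sumFin-cong n (λ v → weight-+ _ _ (X v)) ⟨
      demand X ∎

  Good⇒Goodℕ : MaxMonDeg≤ H D → ∀ s → Good ρ 𝒢 S φ s D → Goodℕ s
  Good⇒Goodℕ maxDeg s good X ∣X∣≤2s =
    ℤP.drop‿+≤+ (ℤP.0≤i-j⇒j≤i (subst (ℤ.+ 0 ℤ.≤_) (Rval≡free-demand maxDeg X) (good X ∣X∣≤2s)))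

  Goodℕ⇒Good : MaxMonDeg≤ H D → ∀ s → Goodℕ s → Good ρ 𝒢 S φ s D
  Goodℕ⇒Good maxDeg s good X ∣X∣≤2s =
    subst (ℤ.+ 0 ℤ.≤_) (sym (Rval≡free-demand maxDeg X)) (ℤP.i≤j⇒0≤j-i (ℤ.+≤+ (good X ∣X∣≤2s)))

  free-submodular : ∀ X Y → free (X ∪ₚ Y) + free (X ∩ₚ Y) ≤ free X + free Y
  free-submodular X Y = begin
    free (X ∪ₚ Y) + free (X ∩ₚ Y)  ≤⟨ +-mono-≤ (p⊆q⇒∣p∣≤∣q∣ ∪-case) (p⊆q⇒∣p∣≤∣q∣ ∩-case) ⟩
    ∣ A ∪ B ∣ + ∣ A ∩ B ∣          ≡⟨ ∣p∪q∣+∣p∩q∣≡∣p∣+∣q∣ A B ⟩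
    free X + free Y                ∎
    where
    open ≤-Reasoning
    A B : Subset n
    A = Γ 𝒢 X ─ Im
    B = Γ 𝒢 Y ─ Im
    ∪-case : Γ 𝒢 (X ∪ₚ Y) ─ Im ⊆ A ∪ B
    ∪-case w∈ with ∈Γ⁻ 𝒢 (X ∪ₚ Y) (p─q⊆p _ _ w∈)
    ... | v , i , i∈X∪Y , w∈adj with x∈p∪q⁻ (X v) (Y v) i∈X∪Y
    ...   | inj₁ i∈X = x∈p∪q⁺ (inj₁ (x∈p∧x∉q⇒x∈p─q (∈Γ⁺ 𝒢 X v i i∈X w∈adj) (x∈p─q⇒x∉q w∈)))
    ...   | inj₂ i∈Y = x∈p∪q⁺ (inj₂ (x∈p∧x∉q⇒x∈p─q (∈Γ⁺ 𝒢 Y v i i∈Y w∈adj) (x∈p─q⇒x∉q w∈)))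
    ∩-case : Γ 𝒢 (X ∩ₚ Y) ─ Im ⊆ A ∩ B
    ∩-case w∈ with ∈Γ⁻ 𝒢 (X ∩ₚ Y) (p─q⊆p _ _ w∈)
    ... | v , i , i∈X∩Y , w∈adj =
      let (i∈X , i∈Y) = x∈p∩q⁻ (X v) (Y v) i∈X∩Y in
      x∈p∩q⁺ ( x∈p∧x∉q⇒x∈p─q (∈Γ⁺ 𝒢 X v i i∈X w∈adj) (x∈p─q⇒x∉q w∈)
             , x∈p∧x∉q⇒x∈p─q (∈Γ⁺ 𝒢 Y v i i∈Y w∈adj) (x∈p─q⇒x∉q w∈))

  demand≤ : ∀ X → demand X ≤ ∣ X ∣ₚ * (D + 1)
  demand≤ X = weightₚ-≤ load X λ v i → +-mono-≤ (m∸n≤m D (degAt ρ 𝒢 S φ i v)) (χ≤1 (P ρ 𝒢 S φ v) i)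

  n≤free+m+∣∁Γ∣ : ∀ X → n ≤ free X + m + ∣ ∁ (Γ 𝒢 X) ∣
  n≤free+m+∣∁Γ∣ X = begin
    n                                           ≡⟨ ∣⊤∣≡n n ⟨
    ∣ ⊤ {n} ∣                                   ≤⟨ p⊆q⇒∣p∣≤∣q∣ cover ⟩
    ∣ ((Γ 𝒢 X ─ Im) ∪ Im) ∪ ∁ (Γ 𝒢 X) ∣         ≤⟨ ∣p∪q∣≤∣p∣+∣q∣ ((Γ 𝒢 X ─ Im) ∪ Im) (∁ (Γ 𝒢 X)) ⟩
    ∣ (Γ 𝒢 X ─ Im) ∪ Im ∣ + ∣ ∁ (Γ 𝒢 X) ∣       ≤⟨ +-monoˡ-≤ ∣ ∁ (Γ 𝒢 X) ∣ (∣p∪q∣≤∣p∣+∣q∣ (Γ 𝒢 X ─ Im) Im) ⟩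
    free X + ∣ Im ∣ + ∣ ∁ (Γ 𝒢 X) ∣             ≤⟨ +-monoˡ-≤ ∣ ∁ (Γ 𝒢 X) ∣ (+-monoʳ-≤ (free X) ∣Im∣≤m) ⟩
    free X + m + ∣ ∁ (Γ 𝒢 X) ∣                  ∎
    where
    open ≤-Reasoning
    cover : ⊤ ⊆ ((Γ 𝒢 X ─ Im) ∪ Im) ∪ ∁ (Γ 𝒢 X)
    cover {w} _ with w ∈? Γ 𝒢 X | w ∈? Im
    ... | no  w∉Γ | _       = x∈p∪q⁺ (inj₂ (x∉p⇒x∈∁p w∉Γ))
    ... | yes _   | yes w∈Im = x∈p∪q⁺ (inj₁ (x∈p∪q⁺ (inj₂ w∈Im)))
    ... | yes w∈Γ | no  w∉Im = x∈p∪q⁺ (inj₁ (x∈p∪q⁺ (inj₁ (x∈p∧x∉q⇒x∈p─q w∈Γ w∉Im))))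

  free-∅ₚ : free ∅ₚ ≡ 0
  free-∅ₚ = n≤0⇒n≡0 (≤-trans (p⊆q⇒∣p∣≤∣q∣ Γ∅─Im⊆⊥) (≤-reflexive (∣⊥∣≡0 n)))
    where Γ∅─Im⊆⊥ : Γ 𝒢 ∅ₚ ─ Im ⊆ ⊥
          Γ∅─Im⊆⊥ w∈ with ∈Γ⁻ 𝒢 ∅ₚ (p─q⊆p _ _ w∈)
          ... | _ , _ , i∈⊥ , _ = contradiction i∈⊥ ∉⊥

  module Joined (s : ℕ) (joined : SJoined s 𝒢) (n-large : m + 2 * s * D + 3 * s ≤ n) where

    ∣∁Γ∣<s : ∀ X → s ≤ ∣ X ∣ₚ → ∣ ∁ (Γ 𝒢 X) ∣ < s
    ∣∁Γ∣<s X s≤∣X∣ = ≰⇒> λ s≤∣∁Γ∣ →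
      let (v , i , w , i∈X , w∈∁Γ , w∈adj) = joined X (∁ (Γ 𝒢 X)) s≤∣X∣ s≤∣∁Γ∣
      in x∈∁p⇒x∉p w∈∁Γ (∈Γ⁺ 𝒢 X v i i∈X w∈adj)

    demand<free : ∀ X → s ≤ ∣ X ∣ₚ → ∣ X ∣ₚ ≤ 2 * s → demand X < free X
    demand<free X s≤∣X∣ ∣X∣≤2s = begin-strict
      demand X          ≤⟨ demand≤ X ⟩
      ∣ X ∣ₚ * (D + 1)  ≤⟨ *-monoˡ-≤ (D + 1) ∣X∣≤2s ⟩
      2 * s * (D + 1)   <⟨ +-cancelʳ-≤ (m + s) _ _ free-large ⟩
      free X            ∎
      where
      open ≤-Reasoning
      free-large : suc (2 * s * (D + 1)) + (m + s) ≤ free X + (m + s)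
      free-large = begin
        suc (2 * s * (D + 1)) + (m + s)  ≡⟨ cong suc (rearrange s D m) ⟩
        suc (m + 2 * s * D + 3 * s)      ≤⟨ s≤s n-large ⟩
        suc n                            ≤⟨ s≤s (n≤free+m+∣∁Γ∣ X) ⟩
        suc (free X + m + ∣ ∁ (Γ 𝒢 X) ∣)  ≡⟨ +-suc (free X + m) _ ⟨
        free X + m + suc ∣ ∁ (Γ 𝒢 X) ∣    ≤⟨ +-monoʳ-≤ (free X + m) (∣∁Γ∣<s X s≤∣X∣) ⟩
        free X + m + s                   ≡⟨ +-assoc (free X) m s ⟩
        free X + (m + s)                 ∎
        where rearrange : ∀ s D m → 2 * s * (D + 1) + (m + s) ≡ m + 2 * s * D + 3 * s
              rearrange = solve-∀

    SmallCritical : PairSet n t → Set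
    SmallCritical X = Critical X × ∣ X ∣ₚ < s

    smallCritical-∅ₚ : 1 ≤ s → SmallCritical ∅ₚ
    smallCritical-∅ₚ 1≤s = subst (_≤ demand ∅ₚ) (sym free-∅ₚ) z≤n , subst (_< s) (sym (∣∅ₚ∣ₚ≡0 {n} {t})) 1≤s

    smallCritical-∪ : Goodℕ s → ∀ {X Y} → SmallCritical X → SmallCritical Y → SmallCritical (X ∪ₚ Y)
    smallCritical-∪ good {X} {Y} (X-critical , ∣X∣<s) (Y-critical , ∣Y∣<s) = X∪Y-critical , ∣X∪Y∣<s
      where
      ∣X∩Y∣≤2s : ∣ X ∩ₚ Y ∣ₚ ≤ 2 * s
      ∣X∩Y∣≤2s = ≤-trans (∣X∩Y∣ₚ≤∣X∣ₚ X Y) (≤-trans (<⇒≤ ∣X∣<s) (m≤m+n s (s + 0)))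

      X∪Y-critical : Critical (X ∪ₚ Y)
      X∪Y-critical = +-cancelʳ-≤ (free (X ∩ₚ Y)) _ _ (begin
        free (X ∪ₚ Y) + free (X ∩ₚ Y)        ≤⟨ free-submodular X Y ⟩
        free X + free Y                      ≤⟨ +-mono-≤ X-critical Y-critical ⟩
        demand X + demand Y                  ≡⟨ weightₚ-∪∩ load X Y ⟨
        demand (X ∪ₚ Y) + demand (X ∩ₚ Y)    ≤⟨ +-monoʳ-≤ (demand (X ∪ₚ Y)) (good (X ∩ₚ Y) ∣X∩Y∣≤2s) ⟩
        demand (X ∪ₚ Y) + free (X ∩ₚ Y)      ∎)
        where open ≤-Reasoning

      ∣X∪Y∣<s : ∣ X ∪ₚ Y ∣ₚ < s
      ∣X∪Y∣<s = ≰⇒> λ s≤∣X∪Y∣ → <⇒≱ (demand<free (X ∪ₚ Y) s≤∣X∪Y∣ ∣X∪Y∣≤2s) X∪Y-critical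
        where ∣X∪Y∣≤2s : ∣ X ∪ₚ Y ∣ₚ ≤ 2 * s
              ∣X∪Y∣≤2s = ≤-trans (∣X∪Y∣ₚ≤∣X∣ₚ+∣Y∣ₚ X Y)
                                 (≤-trans (+-mono-≤ (<⇒≤ ∣X∣<s) (<⇒≤ ∣Y∣<s)) (≤-reflexive (cong (s +_) (sym (+-identityʳ s)))))

module LeafExtension
  {t m n : ℕ} {H : ColGraph t m} (ρ : Rooted H) (𝒢 : GraphFamily t n)
  {D : ℕ} (maxDeg : MaxMonDeg≤ H D) {s : ℕ} (1≤s : 1 ≤ s) (joined : SJoined s 𝒢) (n-large : m + 2 * s * D + 3 * s ≤ n)
  {S′ : Subset m} (removed : LeafRemoved ρ S′) {ℓ : Fin m} (leaf : NonRootLeafIn ρ S′ ℓ)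
  (φ₀ : Fin m → Fin n) (φ₀-emb : IsEmbedding ρ 𝒢 (S′ - ℓ) φ₀)
  (φ₀-good : Surplus.Goodℕ ρ 𝒢 D (S′ - ℓ) φ₀ s)
  where

  S : Subset m
  S = S′ - ℓ

  S⊆S′ : S ⊆ S′
  S⊆S′ = p─q⊆p S′ ⁅ ℓ ⁆

  ℓ∉S : ℓ ∉ S
  ℓ∉S ℓ∈S = x∈p-y⇒x≢y ℓ∈S refl

  private
    ℓ∈S′ : ℓ ∈ S′
    ℓ∈S′ = proj₁ leaf

    deg≡1 : degAllIn H S′ ℓ ≡ 1
    deg≡1 = proj₂ (proj₂ leaf)

    parent : ∃[ p ] ∃[ c ] (p ∈ S′ × col H ℓ p ≡ just c)
    parent = leaf-neighbour H deg≡1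

  p : Fin m
  p = proj₁ parent

  c : Fin t
  c = proj₁ (proj₂ parent)

  p∈S′ : p ∈ S′
  p∈S′ = proj₁ (proj₂ (proj₂ parent))

  ℓp : col H ℓ p ≡ just c
  ℓp = proj₂ (proj₂ (proj₂ parent))

  pℓ : col H p ℓ ≡ just c
  pℓ = trans (ColGraph.sym H p ℓ) ℓp

  p∈S : p ∈ S
  p∈S = x∈p∧x≢y⇒x∈p-y p∈S′ λ p≡ℓ →
    ≡just⇒≢nothing (subst (λ z → col H ℓ z ≡ just c) p≡ℓ ℓp) (ColGraph.irrefl H ℓ)

  parentColour-ℓ : parentColour ρ ℓ ≡ just c
  parentColour-ℓ = parentColour-leaf ρ removed leaf p∈S′ ℓp

  v : Fin n
  v = φ₀ p

  module Old = Surplus ρ 𝒢 D S φ₀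
  open Old.Joined s joined n-large using (SmallCritical; smallCritical-∪; smallCritical-∅ₚ)

  φ₀-injective : ∀ x y → x ∈ S → y ∈ S → φ₀ x ≡ φ₀ y → x ≡ y
  φ₀-injective = proj₁ φ₀-emb

  degAt₀-vc<D : degAt ρ 𝒢 S φ₀ c v < D
  degAt₀-vc<D = begin-strict
    degAt ρ 𝒢 S φ₀ c v  ≡⟨ Old.degAt-φ φ₀-injective c p∈S ⟩
    degIn H S c p       <⟨ degIn-< H S⊆S′ ℓ∈S′ ℓ∉S pℓ ⟩
    degIn H S′ c p      ≤⟨ degIn-mono H (λ _ → ∈⊤) c p ⟩
    degIn H ⊤ c p       ≤⟨ maxDeg c p ⟩
    D                   ∎
    where open ≤-Reasoning

  Candidate : Fin n → Set
  Candidate y = y ∈ adj 𝒢 c v × y ∉ Old.Im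

  Candidate? : ∀ y → Dec (Candidate y)
  Candidate? y = (y ∈? adj 𝒢 c v) ×-dec ¬? (y ∈? Old.Im)

  Blocker : PairSet n t → Set
  Blocker X = SmallCritical X × c ∉ X v

  φ[ℓ↦_] : Fin n → Fin m → Fin n
  φ[ℓ↦ y ] h = if does (h ≟ᶠ ℓ) then y else φ₀ h

  module Extend (y : Fin n) (cand : Candidate y) where

    φ₁ : Fin m → Fin n
    φ₁ = φ[ℓ↦ y ]

    module New = Surplus ρ 𝒢 D S′ φ₁

    φ₁-ℓ : φ₁ ℓ ≡ y
    φ₁-ℓ with ℓ ≟ᶠ ℓ
    ... | yes _   = refl
    ... | no  ℓ≢ℓ = contradiction refl ℓ≢ℓ

    φ₁-agrees : ∀ h → h ∈ S → φ₁ h ≡ φ₀ h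
    φ₁-agrees h h∈S with h ≟ᶠ ℓ
    ... | yes h≡ℓ = contradiction h≡ℓ (x∈p-y⇒x≢y h∈S)
    ... | no  _   = refl

    y∉Im₀ : y ∉ Old.Im
    y∉Im₀ = proj₂ cand

    y≢v : y ≢ v
    y≢v y≡v = y∉Im₀ (Old.∈image⁺ p∈S (sym y≡v))

    φ₁-cases : ∀ h → h ∈ S′ → (h ≡ ℓ × φ₁ h ≡ y) ⊎ (h ∈ S × φ₁ h ≡ φ₀ h)
    φ₁-cases h h∈S′ with h ≟ᶠ ℓ
    ... | yes refl = inj₁ (refl , refl)
    ... | no  h≢ℓ  = inj₂ (x∈p∧x≢y⇒x∈p-y h∈S′ h≢ℓ , refl)

    φ₁-injective : ∀ x x′ → x ∈ S′ → x′ ∈ S′ → φ₁ x ≡ φ₁ x′ → x ≡ x′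
    φ₁-injective x x′ x∈S′ x′∈S′ φ₁x≡φ₁x′ with φ₁-cases x x∈S′ | φ₁-cases x′ x′∈S′
    ... | inj₁ (refl , _)        | inj₁ (refl , _) = refl
    ... | inj₁ (_ , φ₁x≡y)       | inj₂ (x′∈S , φ₁x′≡φ₀x′) =
      contradiction (Old.∈image⁺ x′∈S (trans (sym φ₁x′≡φ₀x′) (trans (sym φ₁x≡φ₁x′) φ₁x≡y))) y∉Im₀
    ... | inj₂ (x∈S , φ₁x≡φ₀x)   | inj₁ (_ , φ₁x′≡y) =
      contradiction (Old.∈image⁺ x∈S (trans (sym φ₁x≡φ₀x) (trans φ₁x≡φ₁x′ φ₁x′≡y))) y∉Im₀
    ... | inj₂ (x∈S , φ₁x≡φ₀x)   | inj₂ (x′∈S , φ₁x′≡φ₀x′) =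
      φ₀-injective x x′ x∈S x′∈S (trans (sym φ₁x≡φ₀x) (trans φ₁x≡φ₁x′ φ₁x′≡φ₀x′))

    φ₁-edges : ∀ x x′ i → x ∈ S′ → x′ ∈ S′ → col H x x′ ≡ just i → φ₁ x′ ∈ adj 𝒢 i (φ₁ x)
    φ₁-edges x x′ i x∈S′ x′∈S′ xx′ with φ₁-cases x x∈S′ | φ₁-cases x′ x′∈S′
    ... | inj₁ (refl , _) | inj₁ (refl , _) = contradiction (ColGraph.irrefl H ℓ) (≡just⇒≢nothing xx′)
    ... | inj₁ (refl , φ₁ℓ≡y) | inj₂ (x′∈S , φ₁x′≡φ₀x′)
      with leaf-neighbour-unique H deg≡1 (S⊆S′ x′∈S) xx′ p∈S′ ℓp
    ...   | refl with just-injective (trans (sym xx′) ℓp)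
    ...     | refl = subst₂ (λ a b → a ∈ adj 𝒢 c b) (sym φ₁x′≡φ₀x′) (sym φ₁ℓ≡y)
                            (GraphFamily.sym 𝒢 c v y (proj₁ cand))
    φ₁-edges x x′ i x∈S′ x′∈S′ xx′ | inj₂ (x∈S , φ₁x≡φ₀x) | inj₁ (refl , φ₁ℓ≡y)
      with leaf-neighbour-unique H deg≡1 (S⊆S′ x∈S) (trans (ColGraph.sym H ℓ x) xx′) p∈S′ ℓp
    ...   | refl with just-injective (trans (sym xx′) pℓ)
    ...     | refl = subst₂ (λ a b → a ∈ adj 𝒢 c b) (sym φ₁ℓ≡y) (sym φ₁x≡φ₀x) (proj₁ cand)
    φ₁-edges x x′ i x∈S′ x′∈S′ xx′ | inj₂ (x∈S , φ₁x≡φ₀x) | inj₂ (x′∈S , φ₁x′≡φ₀x′) =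
      subst₂ (λ a b → a ∈ adj 𝒢 i b) (sym φ₁x′≡φ₀x′) (sym φ₁x≡φ₀x) (proj₂ φ₀-emb x x′ i x∈S x′∈S xx′)

    φ₁-emb : IsEmbedding ρ 𝒢 S′ φ₁
    φ₁-emb = φ₁-injective , φ₁-edges

    ∈Im₁⇒∈Im₀ : ∀ {w} → w ∈ New.Im → w ≢ y → w ∈ Old.Im
    ∈Im₁⇒∈Im₀ w∈Im₁ w≢y with New.∈image⁻ w∈Im₁
    ... | h , h∈S′ , φ₁h≡w with φ₁-cases h h∈S′
    ...   | inj₁ (_ , φ₁h≡y)      = contradiction (trans (sym φ₁h≡w) φ₁h≡y) w≢y
    ...   | inj₂ (h∈S , φ₁h≡φ₀h)  = Old.∈image⁺ h∈S (trans (sym φ₁h≡φ₀h) φ₁h≡w)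

    ∈P₁⇒ : ∀ {u i} → i ∈ P ρ 𝒢 S′ φ₁ u → (u ≡ y × i ≡ c) ⊎ i ∈ P ρ 𝒢 S φ₀ u
    ∈P₁⇒ i∈P₁ with New.∈P⁻ i∈P₁
    ... | h , h∈S′ , φ₁h≡u , colour with φ₁-cases h h∈S′
    ...   | inj₁ (refl , φ₁ℓ≡y)   = inj₁ (trans (sym φ₁h≡u) φ₁ℓ≡y , just-injective (trans (sym colour) parentColour-ℓ))
    ...   | inj₂ (h∈S , φ₁h≡φ₀h)  = inj₂ (Old.∈P⁺ h∈S (trans (sym φ₁h≡φ₀h) φ₁h≡u) colour)

    ∈P₁⇒∈P₀ : ∀ {u i} → u ≢ y → i ∈ P ρ 𝒢 S′ φ₁ u → i ∈ P ρ 𝒢 S φ₀ u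
    ∈P₁⇒∈P₀ u≢y i∈P₁ with ∈P₁⇒ i∈P₁
    ... | inj₁ (u≡y , _) = contradiction u≡y u≢y
    ... | inj₂ i∈P₀      = i∈P₀

    χP₁≤χP₀ : ∀ {u} i → u ≢ y → χ (P ρ 𝒢 S′ φ₁ u) i ≤ χ (P ρ 𝒢 S φ₀ u) i
    χP₁≤χP₀ i u≢y = χ-mono {i = i} (∈P₁⇒∈P₀ u≢y)

    degAt₁-φ₀ : ∀ {h} i → h ∈ S → degAt ρ 𝒢 S′ φ₁ i (φ₀ h) ≡ degIn H S′ i h
    degAt₁-φ₀ {h} i h∈S = trans (cong (degAt ρ 𝒢 S′ φ₁ i) (sym (φ₁-agrees h h∈S)))
                                (New.degAt-φ φ₁-injective i (S⊆S′ h∈S))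

    deg₀≤deg₁ : ∀ u i → degAt ρ 𝒢 S φ₀ i u ≤ degAt ρ 𝒢 S′ φ₁ i u
    deg₀≤deg₁ u i with u ∈? Old.Im
    ... | no  u∉Im₀ = subst (_≤ degAt ρ 𝒢 S′ φ₁ i u) (sym (Old.degAt-∉Im i u∉Im₀)) z≤n
    ... | yes u∈Im₀ with Old.∈image⁻ u∈Im₀
    ...   | h , h∈S , refl = begin
      degAt ρ 𝒢 S φ₀ i (φ₀ h)   ≡⟨ Old.degAt-φ φ₀-injective i h∈S ⟩
      degIn H S i h             ≤⟨ degIn-mono H S⊆S′ i h ⟩
      degIn H S′ i h            ≡⟨ degAt₁-φ₀ i h∈S ⟨
      degAt ρ 𝒢 S′ φ₁ i (φ₀ h)  ∎
      where open ≤-Reasoning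

    deg₀<deg₁-vc : degAt ρ 𝒢 S φ₀ c v < degAt ρ 𝒢 S′ φ₁ c v
    deg₀<deg₁-vc = begin-strict
      degAt ρ 𝒢 S φ₀ c v   ≡⟨ Old.degAt-φ φ₀-injective c p∈S ⟩
      degIn H S c p        <⟨ degIn-< H S⊆S′ ℓ∈S′ ℓ∉S pℓ ⟩
      degIn H S′ c p       ≡⟨ degAt₁-φ₀ c p∈S ⟨
      degAt ρ 𝒢 S′ φ₁ c v  ∎
      where open ≤-Reasoning

    1≤deg₁-cy : 1 ≤ degAt ρ 𝒢 S′ φ₁ c y
    1≤deg₁-cy = begin
      1                         ≤⟨ ≤-trans (s≤s z≤n) (degIn-< H (λ x∈⊥ → contradiction x∈⊥ ∉⊥) p∈S′ ∉⊥ ℓp) ⟩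
      degIn H S′ c ℓ            ≡⟨ New.degAt-φ φ₁-injective c ℓ∈S′ ⟨
      degAt ρ 𝒢 S′ φ₁ c (φ₁ ℓ)  ≡⟨ cong (degAt ρ 𝒢 S′ φ₁ c) φ₁-ℓ ⟩
      degAt ρ 𝒢 S′ φ₁ c y       ∎
      where open ≤-Reasoning

    load₁-y≤D : ∀ i → New.load y i ≤ D
    load₁-y≤D i with i ∈? P ρ 𝒢 S′ φ₁ y
    ... | no  _ = ≤-trans (≤-reflexive (+-identityʳ _)) (m∸n≤m D (degAt ρ 𝒢 S′ φ₁ i y))
    ... | yes i∈P₁ with ∈P₁⇒ i∈P₁
    ...   | inj₂ i∈P₀ = contradiction (let (h , h∈S , φ₀h≡y , _) = Old.∈P⁻ i∈P₀ in Old.∈image⁺ h∈S φ₀h≡y) y∉Im₀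
    ...   | inj₁ (_ , refl) = begin
      D ∸ degAt ρ 𝒢 S′ φ₁ c y + 1                     ≤⟨ +-monoʳ-≤ _ 1≤deg₁-cy ⟩
      D ∸ degAt ρ 𝒢 S′ φ₁ c y + degAt ρ 𝒢 S′ φ₁ c y   ≡⟨ m∸n+n≡m (New.degAt≤ maxDeg c y) ⟩
      D                                               ∎
      where open ≤-Reasoning

    load₁≤load₀ : ∀ u i → New.load u i ≤ Old.load u i
    load₁≤load₀ u i with u ≟ᶠ y
    ... | no  u≢y  = +-mono-≤ (∸-monoʳ-≤ D (deg₀≤deg₁ u i)) (χP₁≤χP₀ i u≢y)
    ... | yes refl = begin
      New.load y i              ≤⟨ load₁-y≤D i ⟩
      D                         ≡⟨ cong (D ∸_) (Old.degAt-∉Im i y∉Im₀) ⟨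
      D ∸ degAt ρ 𝒢 S φ₀ i y    ≤⟨ m≤m+n _ _ ⟩
      Old.load y i              ∎
      where open ≤-Reasoning

    load₁<load₀-vc : New.load v c < Old.load v c
    load₁<load₀-vc = +-mono-<-≤ (∸-monoʳ-< deg₀<deg₁-vc (New.degAt≤ maxDeg c v)) (χP₁≤χP₀ c (y≢v ∘ sym))

    demand₁≤demand₀ : ∀ X → New.demand X ≤ Old.demand X
    demand₁≤demand₀ X = weightₚ-mono X load₁≤load₀

    demand₁<demand₀ : ∀ X → c ∈ X v → New.demand X < Old.demand X
    demand₁<demand₀ X c∈Xv = weightₚ-mono-< X c∈Xv load₁≤load₀ load₁<load₀-vc

    free₀≤1+free₁ : ∀ X → Old.free X ≤ suc (New.free X)
    free₀≤1+free₁ X = begin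
      Old.free X                       ≤⟨ p⊆q⇒∣p∣≤∣q∣ Γ─Im₀⊆ ⟩
      ∣ (Γ 𝒢 X ─ New.Im) ∪ ⁅ y ⁆ ∣      ≤⟨ ∣p∪q∣≤∣p∣+∣q∣ (Γ 𝒢 X ─ New.Im) ⁅ y ⁆ ⟩
      New.free X + ∣ ⁅ y ⁆ ∣            ≡⟨ trans (cong (New.free X +_) (∣⁅x⁆∣≡1 y)) (+-comm _ 1) ⟩
      suc (New.free X)                 ∎
      where
      open ≤-Reasoning
      Γ─Im₀⊆ : Γ 𝒢 X ─ Old.Im ⊆ (Γ 𝒢 X ─ New.Im) ∪ ⁅ y ⁆
      Γ─Im₀⊆ {w} w∈ with w ≟ᶠ y
      ... | yes refl = x∈p∪q⁺ (inj₂ (x∈⁅x⁆ w))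
      ... | no  w≢y  = x∈p∪q⁺ (inj₁ (x∈p∧x∉q⇒x∈p─q (p─q⊆p _ _ w∈) λ w∈Im₁ →
                                      x∈p─q⇒x∉q w∈ (∈Im₁⇒∈Im₀ w∈Im₁ w≢y)))

    free₀≤free₁ : ∀ X → y ∉ Γ 𝒢 X → Old.free X ≤ New.free X
    free₀≤free₁ X y∉ΓX = p⊆q⇒∣p∣≤∣q∣ Γ─Im₀⊆
      where
      Γ─Im₀⊆ : Γ 𝒢 X ─ Old.Im ⊆ Γ 𝒢 X ─ New.Im
      Γ─Im₀⊆ w∈ = let w∈ΓX = p─q⊆p _ _ w∈ in
        x∈p∧x∉q⇒x∈p─q w∈ΓX λ w∈Im₁ → x∈p─q⇒x∉q w∈ (∈Im₁⇒∈Im₀ w∈Im₁ λ { refl → y∉ΓX w∈ΓX })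

    violation⇒blocker : ∀ X → New.Violation s X → Blocker X × y ∈ Γ 𝒢 X
    violation⇒blocker X (∣X∣≤2s , free₁<demand₁) = ((critical , ∣X∣<s) , c∉Xv) , y∈ΓX
      where
      open ≤-Reasoning
      y∈ΓX : y ∈ Γ 𝒢 X
      y∈ΓX with y ∈? Γ 𝒢 X
      ... | yes y∈ΓX = y∈ΓX
      ... | no  y∉ΓX = contradiction (begin-strict
        Old.free X    ≤⟨ free₀≤free₁ X y∉ΓX ⟩
        New.free X    <⟨ free₁<demand₁ ⟩
        New.demand X  ≤⟨ demand₁≤demand₀ X ⟩
        Old.demand X  ≤⟨ φ₀-good X ∣X∣≤2s ⟩
        Old.free X    ∎) (<-irrefl refl)

      critical : Old.Critical X
      critical = begin
        Old.free X          ≤⟨ free₀≤1+free₁ X ⟩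
        suc (New.free X)    ≤⟨ free₁<demand₁ ⟩
        New.demand X        ≤⟨ demand₁≤demand₀ X ⟩
        Old.demand X        ∎

      c∉Xv : c ∉ X v
      c∉Xv c∈Xv = contradiction (begin-strict
        Old.demand X        ≤⟨ φ₀-good X ∣X∣≤2s ⟩
        Old.free X          ≤⟨ critical′ ⟩
        New.demand X        <⟨ demand₁<demand₀ X c∈Xv ⟩
        Old.demand X        ∎) (<-irrefl refl)
        where critical′ : Old.free X ≤ New.demand X
              critical′ = ≤-trans (free₀≤1+free₁ X) free₁<demand₁

      ∣X∣<s : ∣ X ∣ₚ < s
      ∣X∣<s = ≰⇒> λ s≤∣X∣ → <⇒≱ (New.Joined.demand<free s joined n-large X s≤∣X∣ ∣X∣≤2s) (<⇒≤ free₁<demand₁)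

  blocker-∪ : ∀ {X Y} → Blocker X → Blocker Y → Blocker (X ∪ₚ Y)
  blocker-∪ {X} {Y} (X-small , c∉Xv) (Y-small , c∉Yv) =
    smallCritical-∪ φ₀-good X-small Y-small , λ c∈ → [ c∉Xv , c∉Yv ]′ (x∈p∪q⁻ (X v) (Y v) c∈)

  blocker-∅ₚ : Blocker ∅ₚ
  blocker-∅ₚ = smallCritical-∅ₚ 1≤s , ∉⊥

  GoodExtension : Fin n → Set
  GoodExtension y = Σ (Candidate y) λ _ → Surplus.Goodℕ ρ 𝒢 D S′ φ[ℓ↦ y ] s

  extend-or-block : ∀ y → GoodExtension y ⊎ ∃[ X ] (Blocker X × (Candidate y → y ∈ Γ 𝒢 X))
  extend-or-block y with Candidate? y
  ... | no ¬cand = inj₂ (∅ₚ , blocker-∅ₚ , λ cand → contradiction cand ¬cand)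
  ... | yes cand with Surplus.violation? ρ 𝒢 D S′ φ[ℓ↦ y ] s
  ...   | no  ¬violation = inj₁ (cand , Surplus.¬violation⇒Goodℕ ρ 𝒢 D S′ φ[ℓ↦ y ] s ¬violation)
  ...   | yes (X , violation) =
    let (X-blocks , y∈ΓX) = Extend.violation⇒blocker y cand X violation in inj₂ (X , X-blocks , λ _ → y∈ΓX)

  no-covering-blocker : ∀ W → Blocker W → ¬ (∀ y → Candidate y → y ∈ Γ 𝒢 W)
  no-covering-blocker W ((W-critical , ∣W∣<s) , c∉Wv) covers = contradiction (begin-strict
    Old.demand W                 <⟨ m<m+n (Old.demand W) 0<load ⟩
    Old.demand W + Old.load v c  ≡⟨ weightₚ-∪⁅,⁆ₚ Old.load W c∉Wv ⟨
    Old.demand W′                ≤⟨ φ₀-good W′ ∣W′∣≤2s ⟩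
    Old.free W′                  ≤⟨ p⊆q⇒∣p∣≤∣q∣ Γ─Im₀⊆ ⟩
    Old.free W                   ≤⟨ W-critical ⟩
    Old.demand W                 ∎) (<-irrefl refl)
    where
    open ≤-Reasoning
    W′ : PairSet n t
    W′ = W ∪ₚ ⁅ v , c ⁆ₚ

    0<load : 0 < Old.load v c
    0<load = ≤-trans (m<n⇒0<n∸m degAt₀-vc<D) (m≤m+n _ _)

    ∣W′∣≤2s : ∣ W′ ∣ₚ ≤ 2 * s
    ∣W′∣≤2s = begin
      ∣ W′ ∣ₚ                  ≤⟨ ∣X∪Y∣ₚ≤∣X∣ₚ+∣Y∣ₚ W ⁅ v , c ⁆ₚ ⟩
      ∣ W ∣ₚ + ∣ ⁅ v , c ⁆ₚ ∣ₚ  ≡⟨ cong (∣ W ∣ₚ +_) (∣⁅,⁆ₚ∣ₚ≡1 v c) ⟩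
      ∣ W ∣ₚ + 1               ≤⟨ ≤-trans (≤-reflexive (+-comm _ 1)) ∣W∣<s ⟩
      s                        ≤⟨ m≤m+n s (s + 0) ⟩
      2 * s                    ∎

    Γ─Im₀⊆ : Γ 𝒢 W′ ─ Old.Im ⊆ Γ 𝒢 W ─ Old.Im
    Γ─Im₀⊆ {w} w∈ with ∈Γ⁻ 𝒢 W′ (p─q⊆p _ _ w∈)
    ... | u , i , i∈W′u , w∈adj with x∈p∪q⁻ (W u) (⁅ v , c ⁆ₚ u) i∈W′u
    ...   | inj₁ i∈Wu = x∈p∧x∉q⇒x∈p─q (∈Γ⁺ 𝒢 W u i i∈Wu w∈adj) (x∈p─q⇒x∉q w∈)
    ...   | inj₂ i∈⁅⁆ with ∈⁅,⁆ₚ⁻ v c {u} i∈⁅⁆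
    ...     | refl , refl = x∈p∧x∉q⇒x∈p─q (covers w (w∈adj , x∈p─q⇒x∉q w∈)) (x∈p─q⇒x∉q w∈)

  extension : Σ (Fin m → Fin n) λ φ →
              IsEmbedding ρ 𝒢 S′ φ × (∀ h → h ∈ S → φ h ≡ φ₀ h) × Surplus.Goodℕ ρ 𝒢 D S′ φ s
  extension with ∃⊎∀ extend-or-block
  ... | inj₁ (y , cand , good) = φ[ℓ↦ y ] , Extend.φ₁-emb y cand , Extend.φ₁-agrees y cand , good
  ... | inj₂ blocked = contradiction covers (no-covering-blocker W W-blocks)
    where
    F : Fin n → PairSet n t
    F y = proj₁ (blocked y)
    W : PairSet n t
    W = ⋃ₚ F
    W-blocks : Blocker W
    W-blocks = ⋃ₚ-closed Blocker blocker-∅ₚ blocker-∪ F (proj₁ ∘ proj₂ ∘ blocked)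
    covers : ∀ y → Candidate y → y ∈ Γ 𝒢 W
    covers y cand = Γ-mono 𝒢 (λ u → ∈⋃ₚ⁺ F y) (proj₂ (proj₂ (blocked y)) cand)

extend-to-all : ∀ {t m n} {H : ColGraph t m} (ρ : Rooted H) (𝒢 : GraphFamily t n)
                {D} → MaxMonDeg≤ H D → ∀ {s} → 1 ≤ s → SJoined s 𝒢 → m + 2 * s * D + 3 * s ≤ n →
                ∀ {S} → LeafRemoved ρ S → ∀ φ₀ → IsEmbedding ρ 𝒢 S φ₀ → Surplus.Goodℕ ρ 𝒢 D S φ₀ s →
                Σ (Fin m → Fin n) λ φ →
                  IsEmbedding ρ 𝒢 ⊤ φ × (∀ h → h ∈ S → φ h ≡ φ₀ h) × Surplus.Goodℕ ρ 𝒢 D ⊤ φ s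
extend-to-all ρ 𝒢 maxDeg 1≤s joined n-large start φ₀ φ₀-emb φ₀-good = φ₀ , φ₀-emb , (λ _ _ → refl) , φ₀-good
extend-to-all ρ 𝒢 maxDeg 1≤s joined n-large (remove removed leaf) φ₀ φ₀-emb φ₀-good =
  let (φ₁ , φ₁-emb , φ₁-agrees , φ₁-good) =
        LeafExtension.extension ρ 𝒢 maxDeg 1≤s joined n-large removed leaf φ₀ φ₀-emb φ₀-good
      (φ , φ-emb , φ-agrees , φ-good) = extend-to-all ρ 𝒢 maxDeg 1≤s joined n-large removed φ₁ φ₁-emb φ₁-good
  in φ , φ-emb , (λ h h∈S → trans (φ-agrees h (p─q⊆p _ _ h∈S)) (φ₁-agrees h h∈S)) , φ-good

lemma2p9 : (s t D m n : ℕ) → 1 ≤ s → 1 ≤ t → 1 ≤ D →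
  (H : ColGraph t m) (ρ : Rooted H) → MaxMonDeg≤ H D →
  (S : Subset m) → LeafRemoved ρ S →
  (𝒢 : GraphFamily t n) → SJoined s 𝒢 →
  (φ₀ : Fin m → Fin n) → IsEmbedding ρ 𝒢 S φ₀ → Good ρ 𝒢 S φ₀ s D →
  m + 2 * s * D + 3 * s ≤ n →
  Σ (Fin m → Fin n) λ φ →
    IsEmbedding ρ 𝒢 ⊤ φ × (∀ h → h ∈ S → φ h ≡ φ₀ h) × Good ρ 𝒢 ⊤ φ s D
lemma2p9 s t D m n 1≤s _ _ H ρ maxDeg S removed 𝒢 joined φ₀ φ₀-emb φ₀-good n-large =
  let (φ , φ-emb , φ-agrees , φ-good) =
        extend-to-all ρ 𝒢 maxDeg 1≤s joined n-large removed φ₀ φ₀-emb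
                      (Surplus.Good⇒Goodℕ ρ 𝒢 D S φ₀ maxDeg s φ₀-good)
  in φ , φ-emb , φ-agrees , Surplus.Goodℕ⇒Good ρ 𝒢 D ⊤ φ maxDeg s φ-good
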